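{- Let $\omega\ge 2$ and let $\Gamma$ be a finite simple graph on $n$ vertices which is $k$-regular and $\omega$-clique regular, and put $m=\frac{nk}{\omega(\omega-1)}$ (the number of cliques of order $\omega$ in $\Gamma$). Then \[p(C_\omega(\Gamma);\lambda)=(\lambda+\omega)^{m-n}\,p\!\left(\Gamma;\lambda+\omega-\frac{k}{\omega-1}\right),\] where $p(H;\lambda)=\det(\lambda I-A_H)$ denotes the characteristic polynomial of the adjacency matrix $A_H$ of a graph $H$.
   Context: A clique of order $\omega$ is a set of $\omega$ pairwise adjacent vertices. A graph is $\omega$-clique regular if it has a nonempty edge set and every edge lies in exactly one clique of order $\omega$. The $\omega$-clique graph $C_\omega(\Gamma)$ has as vertices the cliques of order $\omega$ in $\Gamma$, two distinct cliques being adjacent iff they have nonempty intersection. (The identity is one of rational functions in $\lambda$ when $m<n$.) -}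

module Defs where

open import Data.Nat as ℕ using (ℕ; zero; suc)
open import Data.Nat.DivMod using ()
open import Data.Integer using (+_)
open import Data.Fin using (Fin; zero; suc; punchIn; toℕ)
open import Data.Fin.Subset using (Subset; _∈_; ∣_∣; _∩_; Nonempty)
open import Data.Fin.Subset.Properties using (nonempty?)
open import Data.Fin.Properties using (_≟_)
open import Data.Bool using (Bool; true; false; if_then_else_)
open import Data.Rational using (ℚ; 0ℚ; 1ℚ; _+_; _*_; _-_; -_) renaming (_/_ to _/ℚ_)
open import Data.Product using (Σ; ∃; _×_; _,_)
open import Relation.Nullary using (¬_; does)
open import Relation.Binary.PropositionalEquality using (_≡_; _≢_)

_^ℚ_ : ℚ → ℕ → ℚ
x ^ℚ zero  = 1ℚ
x ^ℚ suc e = x * (x ^ℚ e)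

ℕ→ℚ : ℕ → ℚ
ℕ→ℚ a = (+ a) /ℚ 1

Mat : ℕ → Set
Mat n = Fin n → Fin n → ℚ

sumFin : ∀ {n} → (Fin n → ℚ) → ℚ
sumFin {zero}  f = 0ℚ
sumFin {suc n} f = f zero + sumFin (λ j → f (suc j))

sign : ℕ → ℚ
sign zero          = 1ℚ
sign (suc zero)    = - 1ℚ
sign (suc (suc j)) = sign j

minor : ∀ {n} → Mat (suc n) → Fin (suc n) → Mat n
minor A j r c = A (suc r) (punchIn j c)

det : ∀ {n} → Mat n → ℚ
det {zero}  A = 1ℚ
det {suc n} A = sumFin (λ j → sign (toℕ j) * (A zero j * det (minor A j)))

record Graph (n : ℕ) : Set where
  field
    adj   : Fin n → Fin n → Bool
    sym   : ∀ i j → adj i j ≡ adj j i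
    irrefl : ∀ i → adj i i ≡ false
open Graph public

adjMat : ∀ {n} → (Fin n → Fin n → Bool) → Mat n
adjMat a i j = if a i j then 1ℚ else 0ℚ

charPoly : ∀ {n} → (Fin n → Fin n → Bool) → ℚ → ℚ
charPoly a x = det (λ i j → (if does (i ≟ j) then x else 0ℚ) - adjMat a i j)

degree : ∀ {n} → Graph n → Fin n → ℕ
degree {zero}  G i = 0
degree {suc n} G i = (if adj G i zero then 1 else 0)
  ℕ.+ degree′ (λ j → adj G i (suc j))
  where
  degree′ : ∀ {m} → (Fin m → Bool) → ℕ
  degree′ {zero}  f = 0
  degree′ {suc m} f = (if f zero then 1 else 0) ℕ.+ degree′ (λ j → f (suc j))

IsRegular : ∀ {n} → Graph n → ℕ → Set
IsRegular G k = ∀ i → degree G i ≡ k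

IsClique : ∀ {n} → Graph n → ℕ → Subset n → Set
IsClique G ω S = ∣ S ∣ ≡ ω × (∀ i j → i ∈ S → j ∈ S → i ≢ j → adj G i j ≡ true)

IsCliqueRegular : ∀ {n} → Graph n → ℕ → Set
IsCliqueRegular {n} G ω =
  (∃ λ i → ∃ λ j → adj G i j ≡ true) ×
  (∀ i j → adj G i j ≡ true →
     (∃ λ S → IsClique G ω S × i ∈ S × j ∈ S) ×
     (∀ S T → IsClique G ω S → i ∈ S → j ∈ S →
              IsClique G ω T → i ∈ T → j ∈ T → S ≡ T))

record CliqueEnum {n} (G : Graph n) (ω M : ℕ) : Set where
  field
    cl       : Fin M → Subset n
    isClique : ∀ a → IsClique G ω (cl a)
    inj      : ∀ a b → cl a ≡ cl b → a ≡ b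
    surj     : ∀ S → IsClique G ω S → ∃ λ a → cl a ≡ S
open CliqueEnum public

cliqueAdj : ∀ {n ω M} {G : Graph n} → CliqueEnum G ω M → Fin M → Fin M → Bool
cliqueAdj E a b =
  if does (a ≟ b) then false else does (nonempty? (cl E a ∩ cl E b))

-- Let N be the n × m vertex–clique incidence matrix of Γ. Two distinct ω-cliques share at most one
-- vertex, as an edge lies in only one of them, so NᵀN = A_C + ωI. The edges at a vertex are
-- partitioned by the cliques through it, so every vertex lies in r = k/(ω-1) cliques and NNᵀ = A_Γ + rI;
-- counting incidences gives mω = nr. Sylvester's identity det(tI - NNᵀ) tᵐ = tⁿ det(tI - NᵀN) at
-- t = λ + ω is then the claim. It comes from two block-triangular factorisations of [[tI, N], [Nᵀ, I]]
-- and the product formula for det, which holds because every alternating multilinear function of the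
-- columns is a multiple of det. For t = 0 the powers of t cannot be cancelled; there NᵀN factors
-- through ℚⁿ, so det(-NᵀN) = 0 when n < m, and the product formula settles n = m.

module Submission where

open import Defs hiding (sym)
open import Algebra.Bundles using (CommutativeRing)
open import Data.Bool.Base using (Bool; true; false; if_then_else_; _∧_)
open import Data.Bool.Properties using (∧-idem)
open import Data.Empty using (⊥-elim)
open import Data.Fin.Base using (Fin; zero; suc; toℕ; fromℕ<; inject₁; punchIn; punchOut; splitAt; _↑ˡ_; _↑ʳ_; _<_)
open import Data.Fin.Induction using (<-weakInduction)
open import Data.Fin.Properties
  using (_≟_; toℕ-injective; toℕ-inject₁; toℕ<n; toℕ-fromℕ<; toℕ-↑ˡ; suc-injective; <-cmp; ≤∧≢⇒<;
         punchIn-injective; punchInᵢ≢i; punchIn-punchOut; punchOut-cong; punchOut-punchIn;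
         splitAt-↑ˡ; splitAt-↑ʳ; join-splitAt)
open import Data.Fin.Subset using (Subset; _∈_; ∣_∣; _∩_)
open import Data.Fin.Subset.Properties using (nonempty?; x∈p∩q⁺; x∈p∩q⁻)
open import Data.Integer.Base as ℤ using ()
import Data.Integer.Properties as ℤ
open import Data.Nat.Base as ℕ using (ℕ; zero; suc; _∸_; _≤_)
import Data.Nat.Coprimality as Coprime
open import Data.Nat.DivMod using (_/_; m*n/n≡m)
import Data.Nat.Properties as ℕ
open import Data.Product.Base using (Σ; ∃; _×_; _,_; proj₁; proj₂)
open import Data.Rational.Base using (ℚ; 0ℚ; 1ℚ; _+_; _*_; _-_; -_; 1/_; NonZero; ≢-nonZero; mkℚ; ↥_)
  renaming (_/_ to _/ℚ_)
import Data.Rational.Properties as ℚ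
open import Data.Rational.Solver using (module +-*-Solver)
open import Data.Rational.Unnormalised.Base using (mkℚᵘ; *≡*)
open import Data.Sum.Base using (_⊎_; inj₁; inj₂; [_,_]′)
open import Data.Vec.Base using ([]; _∷_; lookup; tabulate)
open import Data.Vec.Properties using (lookup∘tabulate; []=⇒lookup; lookup⇒[]=)
open import Function.Base using (_∘_)
open import Relation.Binary.Definitions using (tri<; tri≈; tri>)
open import Relation.Binary.PropositionalEquality
open import Relation.Nullary using (Dec; does; yes; no)
open import Relation.Nullary.Decidable using (dec-true; dec-false)

open import Algebra.Properties.Semiring.Sum (CommutativeRing.semiring ℚ.+-*-commutativeRing)
  using (sum; sum-cong-≗; sum-replicate-zero; sum-remove; ∑-distrib-+; ∑-comm; *-distribˡ-sum; *-distribʳ-sum)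

open +-*-Solver
open ≡-Reasoning

sumFin≡sum : ∀ {n} (f : Fin n → ℚ) → sumFin f ≡ sum f
sumFin≡sum {zero}  f = refl
sumFin≡sum {suc n} f = cong (f zero +_) (sumFin≡sum (f ∘ suc))

sumFin-cong : ∀ {n} {f g : Fin n → ℚ} → (∀ i → f i ≡ g i) → sumFin f ≡ sumFin g
sumFin-cong {f = f} {g} f≗g rewrite sumFin≡sum f | sumFin≡sum g = sum-cong-≗ f≗g

sumFin-zero : ∀ {n} (f : Fin n → ℚ) → (∀ i → f i ≡ 0ℚ) → sumFin f ≡ 0ℚ
sumFin-zero {n} f f≗0 rewrite sumFin≡sum f = trans (sum-cong-≗ f≗0) (sum-replicate-zero n)

sumFin-distrib-+ : ∀ {n} (f g : Fin n → ℚ) → sumFin (λ i → f i + g i) ≡ sumFin f + sumFin g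
sumFin-distrib-+ f g rewrite sumFin≡sum f | sumFin≡sum g | sumFin≡sum (λ i → f i + g i) = ∑-distrib-+ f g

*-distribˡ-sumFin : ∀ {n} c (f : Fin n → ℚ) → c * sumFin f ≡ sumFin (λ i → c * f i)
*-distribˡ-sumFin c f rewrite sumFin≡sum f | sumFin≡sum (λ i → c * f i) = *-distribˡ-sum c f

*-distribʳ-sumFin : ∀ {n} c (f : Fin n → ℚ) → sumFin f * c ≡ sumFin (λ i → f i * c)
*-distribʳ-sumFin c f rewrite sumFin≡sum f | sumFin≡sum (λ i → f i * c) = *-distribʳ-sum c f

sumFin-remove : ∀ {n} (i : Fin (suc n)) (f : Fin (suc n) → ℚ) → sumFin f ≡ f i + sumFin (f ∘ punchIn i)
sumFin-remove i f rewrite sumFin≡sum f | sumFin≡sum (f ∘ punchIn i) = sum-remove f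

sumFin-singleton : ∀ {n} (f : Fin n → ℚ) i → (∀ j → j ≢ i → f j ≡ 0ℚ) → sumFin f ≡ f i
sumFin-singleton {suc n} f i vanish = begin
  sumFin f                    ≡⟨ sumFin-remove i f ⟩
  f i + sumFin (f ∘ punchIn i) ≡⟨ cong (f i +_) (sumFin-zero _ (λ j → vanish (punchIn i j) (punchInᵢ≢i i j))) ⟩
  f i + 0ℚ                    ≡⟨ ℚ.+-identityʳ (f i) ⟩
  f i                         ∎

sumFin-pair : ∀ {n} (f : Fin n → ℚ) {p q} → p ≢ q → (∀ j → j ≢ p → j ≢ q → f j ≡ 0ℚ) → sumFin f ≡ f p + f q
sumFin-pair {suc n} f {p} {q} p≢q vanish = begin
  sumFin f                                ≡⟨ sumFin-remove p f ⟩
  f p + sumFin (f ∘ punchIn p)             ≡⟨ cong (f p +_) (sumFin-singleton _ (punchOut p≢q) vanish′) ⟩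
  f p + f (punchIn p (punchOut p≢q))       ≡⟨ cong (λ c → f p + f c) (punchIn-punchOut p≢q) ⟩
  f p + f q                               ∎
  where
  vanish′ : ∀ j → j ≢ punchOut p≢q → f (punchIn p j) ≡ 0ℚ
  vanish′ j j≢ = vanish (punchIn p j) (punchInᵢ≢i p j)
    (λ e → j≢ (punchIn-injective p j _ (trans e (sym (punchIn-punchOut p≢q)))))

sumFin-splitAt : ∀ {m n} (f : Fin (m ℕ.+ n) → ℚ) → sumFin f ≡ sumFin (λ i → f (i ↑ˡ n)) + sumFin (λ j → f (m ↑ʳ j))
sumFin-splitAt {zero}      f = sym (ℚ.+-identityˡ (sumFin f))
sumFin-splitAt {suc m} {n} f =
  trans (cong (f zero +_) (sumFin-splitAt {m} {n} (f ∘ suc))) (sym (ℚ.+-assoc (f zero) _ _))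

sumFin-comm : ∀ {m n} (f : Fin m → Fin n → ℚ) →
  sumFin (λ i → sumFin (f i)) ≡ sumFin (λ j → sumFin (λ i → f i j))
sumFin-comm f = trans (sumFin²≡sum² f) (trans (∑-comm f) (sym (sumFin²≡sum² (λ j i → f i j))))
  where
  sumFin²≡sum² : ∀ {m n} (g : Fin m → Fin n → ℚ) → sumFin (λ i → sumFin (g i)) ≡ sum (λ i → sum (g i))
  sumFin²≡sum² g = trans (sumFin-cong (λ i → sumFin≡sum (g i))) (sumFin≡sum (λ i → sum (g i)))

-- Multilinearity and alternation of det in the columns

infix 4 _≐_

_≐_ : ∀ {a b} → (Fin a → Fin b → ℚ) → (Fin a → Fin b → ℚ) → Set
A ≐ B = ∀ i j → A i j ≡ B i j

laplaceTerm : ∀ {n} → Mat (suc n) → Fin (suc n) → ℚ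
laplaceTerm A k = sign (toℕ k) * (A zero k * det (minor A k))

AgreeOff : ∀ {n} → Fin n → Mat n → Mat n → Set
AgreeOff j A B = ∀ i c → c ≢ j → A i c ≡ B i c

ColAdditive : ∀ {n} → (Mat n → ℚ) → Set
ColAdditive D = ∀ j A B C → AgreeOff j A C → AgreeOff j B C → (∀ i → C i j ≡ A i j + B i j) → D C ≡ D A + D B

ColHomogeneous : ∀ {n} → (Mat n → ℚ) → Set
ColHomogeneous D = ∀ j s A C → AgreeOff j A C → (∀ i → C i j ≡ s * A i j) → D C ≡ s * D A

Alternating : ∀ {n} → (Mat n → ℚ) → Set
Alternating D = ∀ A p q → p ≢ q → (∀ i → A i p ≡ A i q) → D A ≡ 0ℚ

det-cong : ∀ {n} {A B : Mat n} → A ≐ B → det A ≡ det B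
det-cong {zero}  A≐B = refl
det-cong {suc n} A≐B = sumFin-cong (λ k → cong₂ (λ a d → sign (toℕ k) * (a * d)) (A≐B zero k)
  (det-cong (λ r c → A≐B (suc r) (punchIn k c))))

sign-suc : ∀ m → sign (suc m) ≡ - sign m
sign-suc zero    = refl
sign-suc (suc m) = trans (solve 1 (λ s → s := :- (:- s)) refl (sign m)) (cong -_ (sym (sign-suc m)))

minor-agreeOff : ∀ {n} {A B : Mat (suc n)} {j k} (k≢j : k ≢ j) → AgreeOff j A B →
  AgreeOff (punchOut k≢j) (minor A k) (minor B k)
minor-agreeOff {k = k} k≢j A≈B r c c≢ = A≈B (suc r) (punchIn k c)
  (λ e → c≢ (punchIn-injective k c _ (trans e (sym (punchIn-punchOut k≢j)))))

minor-agreeOff-self : ∀ {n} {A B : Mat (suc n)} {j} → AgreeOff j A B → minor A j ≐ minor B j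
minor-agreeOff-self {j = j} A≈B r c = A≈B (suc r) (punchIn j c) (punchInᵢ≢i j c)

det-col-+ : ∀ {n} → ColAdditive (det {n})
det-col-+ {suc n} j A B C A≈C B≈C Cj = trans (sumFin-cong term-+) (sumFin-distrib-+ (laplaceTerm A) (laplaceTerm B))
  where
  term-+ : ∀ k → laplaceTerm C k ≡ laplaceTerm A k + laplaceTerm B k
  term-+ k with k ≟ j
  ... | yes refl = begin
    sign (toℕ k) * (C zero k * det (minor C k))
      ≡⟨ cong₂ (λ c d → sign (toℕ k) * (c * d)) (Cj zero) (det-cong (λ r c → sym (minor-agreeOff-self A≈C r c))) ⟩
    sign (toℕ k) * ((A zero k + B zero k) * det (minor A k))
      ≡⟨ solve 4 (λ s a b d → s :* ((a :+ b) :* d) := s :* (a :* d) :+ s :* (b :* d)) refl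
           (sign (toℕ k)) (A zero k) (B zero k) (det (minor A k)) ⟩
    laplaceTerm A k + sign (toℕ k) * (B zero k * det (minor A k))
      ≡⟨ cong (λ d → laplaceTerm A k + sign (toℕ k) * (B zero k * d))
           (det-cong (λ r c → trans (minor-agreeOff-self A≈C r c) (sym (minor-agreeOff-self B≈C r c)))) ⟩
    laplaceTerm A k + laplaceTerm B k ∎
  ... | no k≢j = begin
    sign (toℕ k) * (C zero k * det (minor C k))
      ≡⟨ cong₂ (λ c d → sign (toℕ k) * (c * d)) (sym (A≈C zero k k≢j))
           (det-col-+ (punchOut k≢j) (minor A k) (minor B k) (minor C k)
             (minor-agreeOff k≢j A≈C) (minor-agreeOff k≢j B≈C) minorCj) ⟩
    sign (toℕ k) * (A zero k * (det (minor A k) + det (minor B k)))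
      ≡⟨ solve 4 (λ s a x y → s :* (a :* (x :+ y)) := s :* (a :* x) :+ s :* (a :* y)) refl
           (sign (toℕ k)) (A zero k) (det (minor A k)) (det (minor B k)) ⟩
    laplaceTerm A k + sign (toℕ k) * (A zero k * det (minor B k))
      ≡⟨ cong (λ a → laplaceTerm A k + sign (toℕ k) * (a * det (minor B k)))
           (trans (A≈C zero k k≢j) (sym (B≈C zero k k≢j))) ⟩
    laplaceTerm A k + laplaceTerm B k ∎
    where
    minorCj : ∀ r → minor C k r (punchOut k≢j) ≡ minor A k r (punchOut k≢j) + minor B k r (punchOut k≢j)
    minorCj r = subst (λ c → C (suc r) c ≡ A (suc r) c + B (suc r) c) (sym (punchIn-punchOut k≢j)) (Cj (suc r))

det-col-* : ∀ {n} → ColHomogeneous (det {n})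
det-col-* {suc n} j s A C A≈C Cj = trans (sumFin-cong term-*) (sym (*-distribˡ-sumFin s (laplaceTerm A)))
  where
  term-* : ∀ k → laplaceTerm C k ≡ s * laplaceTerm A k
  term-* k with k ≟ j
  ... | yes refl = begin
    sign (toℕ k) * (C zero k * det (minor C k))
      ≡⟨ cong₂ (λ c d → sign (toℕ k) * (c * d)) (Cj zero) (det-cong (λ r c → sym (minor-agreeOff-self A≈C r c))) ⟩
    sign (toℕ k) * ((s * A zero k) * det (minor A k))
      ≡⟨ solve 4 (λ t s a d → t :* ((s :* a) :* d) := s :* (t :* (a :* d))) refl
           (sign (toℕ k)) s (A zero k) (det (minor A k)) ⟩
    s * laplaceTerm A k ∎
  ... | no k≢j = begin
    sign (toℕ k) * (C zero k * det (minor C k))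
      ≡⟨ cong₂ (λ c d → sign (toℕ k) * (c * d)) (sym (A≈C zero k k≢j))
           (det-col-* (punchOut k≢j) s (minor A k) (minor C k) (minor-agreeOff k≢j A≈C) minorCj) ⟩
    sign (toℕ k) * (A zero k * (s * det (minor A k)))
      ≡⟨ solve 4 (λ t s a d → t :* (a :* (s :* d)) := s :* (t :* (a :* d))) refl
           (sign (toℕ k)) s (A zero k) (det (minor A k)) ⟩
    s * laplaceTerm A k ∎
    where
    minorCj : ∀ r → minor C k r (punchOut k≢j) ≡ s * minor A k r (punchOut k≢j)
    minorCj r = subst (λ c → C (suc r) c ≡ s * A (suc r) c) (sym (punchIn-punchOut k≢j)) (Cj (suc r))

inject₁≢suc : ∀ {n} (i : Fin n) → inject₁ i ≢ suc i
inject₁≢suc (suc i) e = inject₁≢suc i (suc-injective e)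

punchIn-inject₁-self : ∀ {n} (i : Fin n) → punchIn (inject₁ i) i ≡ suc i
punchIn-inject₁-self zero    = refl
punchIn-inject₁-self (suc i) = cong suc (punchIn-inject₁-self i)

punchIn-suc-self : ∀ {n} (i : Fin n) → punchIn (suc i) i ≡ inject₁ i
punchIn-suc-self zero    = refl
punchIn-suc-self (suc i) = cong suc (punchIn-suc-self i)

punchIn-inject₁≡punchIn-suc : ∀ {n} (i c : Fin n) → c ≢ i → punchIn (inject₁ i) c ≡ punchIn (suc i) c
punchIn-inject₁≡punchIn-suc zero    zero    c≢i = ⊥-elim (c≢i refl)
punchIn-inject₁≡punchIn-suc zero    (suc c) _   = refl
punchIn-inject₁≡punchIn-suc (suc i) zero    _   = refl
punchIn-inject₁≡punchIn-suc (suc i) (suc c) c≢i = cong suc (punchIn-inject₁≡punchIn-suc i c (c≢i ∘ cong suc))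

punchOut-adjacent : ∀ {n} (i : Fin (suc n)) {k} (k≢i : k ≢ inject₁ i) (k≢si : k ≢ suc i) →
  ∃ λ i′ → punchOut k≢i ≡ inject₁ i′ × punchOut k≢si ≡ suc i′
punchOut-adjacent zero          {zero}                k≢i _   = ⊥-elim (k≢i refl)
punchOut-adjacent zero          {suc zero}            _   k≢si = ⊥-elim (k≢si refl)
punchOut-adjacent zero          {suc (suc zero)}      _   _   = zero , refl , refl
punchOut-adjacent zero          {suc (suc (suc k))}   _   _   = zero , refl , refl
punchOut-adjacent (suc i)       {zero}                _   _   = i , refl , refl
punchOut-adjacent (suc zero)    {suc k} k≢i k≢si with punchOut-adjacent zero (k≢i ∘ cong suc) (k≢si ∘ cong suc)
... | i′ , e₁ , e₂ = suc i′ , cong suc e₁ , cong suc e₂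
punchOut-adjacent (suc (suc i)) {suc k} k≢i k≢si with punchOut-adjacent (suc i) (k≢i ∘ cong suc) (k≢si ∘ cong suc)
... | i′ , e₁ , e₂ = suc i′ , cong suc e₁ , cong suc e₂

minor-inject₁≐minor-suc : ∀ {n} (A : Mat (suc n)) (i : Fin n) → (∀ r → A r (inject₁ i) ≡ A r (suc i)) →
  minor A (inject₁ i) ≐ minor A (suc i)
minor-inject₁≐minor-suc A i cols r c with c ≟ i
... | yes refl = begin
  A (suc r) (punchIn (inject₁ c) c) ≡⟨ cong (A (suc r)) (punchIn-inject₁-self c) ⟩
  A (suc r) (suc c)                 ≡⟨ sym (cols (suc r)) ⟩
  A (suc r) (inject₁ c)             ≡⟨ cong (A (suc r)) (sym (punchIn-suc-self c)) ⟩
  A (suc r) (punchIn (suc c) c)     ∎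
... | no c≢i = cong (A (suc r)) (punchIn-inject₁≡punchIn-suc i c c≢i)

-- Only the Laplace terms at the two equal columns survive (the others vanish by induction); their
-- minors coincide and their signs are opposite.
det-adjacent : ∀ {n} (A : Mat (suc n)) (i : Fin n) → (∀ r → A r (inject₁ i) ≡ A r (suc i)) → det A ≡ 0ℚ
det-adjacent {suc n} A i cols = trans (sumFin-pair (laplaceTerm A) (inject₁≢suc i) others) cancel
  where
  others : ∀ k → k ≢ inject₁ i → k ≢ suc i → laplaceTerm A k ≡ 0ℚ
  others k k≢i k≢si with punchOut-adjacent i k≢i k≢si
  ... | i′ , e₁ , e₂ = trans (cong (λ d → sign (toℕ k) * (A zero k * d)) (det-adjacent (minor A k) i′ cols′))
    (solve 2 (λ s a → s :* (a :* con 0ℚ) := con 0ℚ) refl (sign (toℕ k)) (A zero k))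
    where
    cols′ : ∀ r → minor A k r (inject₁ i′) ≡ minor A k r (suc i′)
    cols′ r = begin
      A (suc r) (punchIn k (inject₁ i′))     ≡⟨ cong (A (suc r) ∘ punchIn k) (sym e₁) ⟩
      A (suc r) (punchIn k (punchOut k≢i))   ≡⟨ cong (A (suc r)) (punchIn-punchOut k≢i) ⟩
      A (suc r) (inject₁ i)                  ≡⟨ cols (suc r) ⟩
      A (suc r) (suc i)                      ≡⟨ cong (A (suc r)) (sym (punchIn-punchOut k≢si)) ⟩
      A (suc r) (punchIn k (punchOut k≢si))  ≡⟨ cong (A (suc r) ∘ punchIn k) e₂ ⟩
      A (suc r) (punchIn k (suc i′))         ∎
  cancel : laplaceTerm A (inject₁ i) + laplaceTerm A (suc i) ≡ 0ℚ
  cancel = begin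
    laplaceTerm A (inject₁ i) + sign (suc (toℕ i)) * (A zero (suc i) * det (minor A (suc i)))
      ≡⟨ cong₂ (λ s x → laplaceTerm A (inject₁ i) + s * x)
           (trans (sign-suc (toℕ i)) (cong (-_ ∘ sign) (sym (toℕ-inject₁ i))))
           (cong₂ _*_ (sym (cols zero)) (sym (det-cong (minor-inject₁≐minor-suc A i cols)))) ⟩
    laplaceTerm A (inject₁ i) + (- sign (toℕ (inject₁ i))) * (A zero (inject₁ i) * det (minor A (inject₁ i)))
      ≡⟨ solve 3 (λ s a d → s :* (a :* d) :+ (:- s) :* (a :* d) := con 0ℚ) refl
           (sign (toℕ (inject₁ i))) (A zero (inject₁ i)) (det (minor A (inject₁ i))) ⟩
    0ℚ ∎

setCol : ∀ {n} → Fin n → (Fin n → ℚ) → Mat n → Mat n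
setCol j v A i c = if does (c ≟ j) then v i else A i c

setCol-≡ : ∀ {n} j v (A : Mat n) i → setCol j v A i j ≡ v i
setCol-≡ j v A i rewrite dec-true (j ≟ j) refl = refl

setCol-≢ : ∀ {n} {j c} v (A : Mat n) i → c ≢ j → setCol j v A i c ≡ A i c
setCol-≢ {j = j} {c} v A i c≢j rewrite dec-false (c ≟ j) c≢j = refl

setCol-agreeOff : ∀ {n} j u v (A : Mat n) → AgreeOff j (setCol j u A) (setCol j v A)
setCol-agreeOff j u v A i c c≢j = trans (setCol-≢ u A i c≢j) (sym (setCol-≢ v A i c≢j))

setCol-comm : ∀ {n} {p q} u v (A : Mat n) → p ≢ q → setCol p u (setCol q v A) ≐ setCol q v (setCol p u A)
setCol-comm {p = p} {q} u v A p≢q i c with c ≟ p | c ≟ q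
... | yes refl | yes refl = ⊥-elim (p≢q refl)
... | yes refl | no _     = refl
... | no _     | yes refl = refl
... | no _     | no _     = refl

swapCols : ∀ {n} → Fin n → Fin n → Mat n → Mat n
swapCols p q A = setCol p (λ i → A i q) (setCol q (λ i → A i p) A)

swapCols-≡ˡ : ∀ {n} p q (A : Mat n) i → swapCols p q A i p ≡ A i q
swapCols-≡ˡ p q A i = setCol-≡ p (λ r → A r q) (setCol q (λ r → A r p) A) i

swapCols-≡ʳ : ∀ {n} {p q} (A : Mat n) i → p ≢ q → swapCols p q A i q ≡ A i p
swapCols-≡ʳ {p = p} {q} A i p≢q =
  trans (setCol-≢ (λ r → A r q) (setCol q (λ r → A r p) A) i (p≢q ∘ sym)) (setCol-≡ q (λ r → A r p) A i)

swapCols-≢ : ∀ {n} {p q c} (A : Mat n) i → c ≢ p → c ≢ q → swapCols p q A i c ≡ A i c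
swapCols-≢ {p = p} {q} A i c≢p c≢q =
  trans (setCol-≢ (λ r → A r q) (setCol q (λ r → A r p) A) i c≢p) (setCol-≢ (λ r → A r p) A i c≢q)

module _ {n} {D : Mat n → ℚ} (D-cong : ∀ {A B} → A ≐ B → D A ≡ D B) (D-+ : ColAdditive D) where

  setCol-+ : ∀ j u v (A : Mat n) → D (setCol j (λ i → u i + v i) A) ≡ D (setCol j u A) + D (setCol j v A)
  setCol-+ j u v A = D-+ j (setCol j u A) (setCol j v A) (setCol j (λ i → u i + v i) A)
    (setCol-agreeOff j u _ A) (setCol-agreeOff j v _ A)
    (λ i → trans (setCol-≡ j (λ r → u r + v r) A i) (sym (cong₂ _+_ (setCol-≡ j u A i) (setCol-≡ j v A i))))

  -- 0 = D(a+b, a+b) expands bilinearly to D(a,a) + D(a,b) + D(b,a) + D(b,b) = D A + D (swapCols p q A).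
  swapCols-negates : ∀ {p q} → p ≢ q → (∀ A → (∀ i → A i p ≡ A i q) → D A ≡ 0ℚ) →
    ∀ A → D (swapCols p q A) ≡ - D A
  swapCols-negates {p} {q} p≢q vanish A = begin
    D (M b a)                            ≡⟨ solve 2 (λ x y → y := (x :+ y) :- x) refl (D (M a b)) (D (M b a)) ⟩
    (D (M a b) + D (M b a)) - D (M a b)  ≡⟨ cong₂ _-_ sum≡0 (D-cong (λ i c → sym (A≐Mab i c))) ⟩
    0ℚ - D A                             ≡⟨ ℚ.+-identityˡ (- D A) ⟩
    - D A                                ∎
    where
    a b : Fin n → ℚ
    a i = A i p
    b i = A i q
    M : (Fin n → ℚ) → (Fin n → ℚ) → Mat n
    M u v = setCol p u (setCol q v A)
    A≐Mab : A ≐ M a b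
    A≐Mab i c with c ≟ p | c ≟ q
    ... | yes refl | _        = refl
    ... | no _     | yes refl = refl
    ... | no _     | no _     = refl
    M-diag : ∀ w → D (M w w) ≡ 0ℚ
    M-diag w = vanish (M w w) (λ i → trans (setCol-≡ p w (setCol q w A) i)
      (sym (trans (setCol-≢ w (setCol q w A) i (p≢q ∘ sym)) (setCol-≡ q w A i))))
    M-+ˡ : ∀ u v w → D (M (λ i → u i + v i) w) ≡ D (M u w) + D (M v w)
    M-+ˡ u v w = setCol-+ p u v (setCol q w A)
    M-+ʳ : ∀ w u v → D (M w (λ i → u i + v i)) ≡ D (M w u) + D (M w v)
    M-+ʳ w u v = begin
      D (M w (λ i → u i + v i))
        ≡⟨ D-cong (setCol-comm w _ A p≢q) ⟩
      D (setCol q (λ i → u i + v i) (setCol p w A))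
        ≡⟨ setCol-+ q u v (setCol p w A) ⟩
      D (setCol q u (setCol p w A)) + D (setCol q v (setCol p w A))
        ≡⟨ sym (cong₂ _+_ (D-cong (setCol-comm w u A p≢q)) (D-cong (setCol-comm w v A p≢q))) ⟩
      D (M w u) + D (M w v) ∎
    ab : Fin n → ℚ
    ab i = a i + b i
    sum≡0 : D (M a b) + D (M b a) ≡ 0ℚ
    sum≡0 = begin
      D (M a b) + D (M b a)
        ≡⟨ solve 2 (λ x y → x :+ y := (con 0ℚ :+ x) :+ (y :+ con 0ℚ)) refl (D (M a b)) (D (M b a)) ⟩
      (0ℚ + D (M a b)) + (D (M b a) + 0ℚ)
        ≡⟨ cong₂ (λ x y → (x + D (M a b)) + (D (M b a) + y)) (sym (M-diag a)) (sym (M-diag b)) ⟩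
      (D (M a a) + D (M a b)) + (D (M b a) + D (M b b))
        ≡⟨ sym (cong₂ _+_ (M-+ʳ a a b) (M-+ʳ b a b)) ⟩
      D (M a ab) + D (M b ab)
        ≡⟨ sym (M-+ˡ a b ab) ⟩
      D (M ab ab)
        ≡⟨ M-diag ab ⟩
      0ℚ ∎

det-equal-cols-< : ∀ {n} q (A : Mat (suc n)) p → p < q → (∀ i → A i p ≡ A i q) → det A ≡ 0ℚ
det-equal-cols-< = <-weakInduction _ (λ _ _ ()) step
  where
  step : ∀ {n} (j : Fin n) → (∀ A p → p < inject₁ j → (∀ i → A i p ≡ A i (inject₁ j)) → det A ≡ 0ℚ) →
    ∀ A p → p < suc j → (∀ i → A i p ≡ A i (suc j)) → det A ≡ 0ℚ
  step j below A p p<sj cols with p ≟ inject₁ j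
  ... | yes refl = det-adjacent A j cols
  ... | no p≢j = begin
    det A
      ≡⟨ solve 1 (λ x → x := :- (:- x)) refl (det A) ⟩
    - (- det A)
      ≡⟨ cong -_ (sym (swapCols-negates det-cong det-col-+ (inject₁≢suc j) (λ B → det-adjacent B j) A)) ⟩
    - det (swapCols (inject₁ j) (suc j) A)
      ≡⟨ cong -_ (below _ p p<j colsB) ⟩
    - 0ℚ
      ≡⟨⟩
    0ℚ ∎
    where
    p<j : p < inject₁ j
    p<j = ≤∧≢⇒< (subst (toℕ p ℕ.≤_) (sym (toℕ-inject₁ j)) (ℕ.≤-pred p<sj)) p≢j
    p≢sj : p ≢ suc j
    p≢sj e = ℕ.<-irrefl (cong toℕ e) p<sj
    colsB : ∀ i → swapCols (inject₁ j) (suc j) A i p ≡ swapCols (inject₁ j) (suc j) A i (inject₁ j)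
    colsB i = trans (swapCols-≢ A i p≢j p≢sj) (trans (cols i) (sym (swapCols-≡ˡ (inject₁ j) (suc j) A i)))

det-equal-cols : ∀ {n} → Alternating (det {n})
det-equal-cols {suc n} A p q p≢q cols with <-cmp p q
... | tri< p<q _ _ = det-equal-cols-< q A p p<q cols
... | tri≈ _ p≡q _ = ⊥-elim (p≢q p≡q)
... | tri> _ _ q<p = det-equal-cols-< p A q q<p (λ i → sym (cols i))

-- Alternating multilinear functions of the columns

record IsAltMultilinear {n} (D : Mat n → ℚ) : Set where
  field
    resp-≐      : ∀ {A B} → A ≐ B → D A ≡ D B
    additive    : ColAdditive D
    homogeneous : ColHomogeneous D
    alternating : Alternating D

det-isAltMultilinear : ∀ {n} → IsAltMultilinear (det {n})
det-isAltMultilinear = record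
  { resp-≐ = det-cong ; additive = det-col-+ ; homogeneous = det-col-* ; alternating = det-equal-cols }

setCol-self : ∀ {n} j (A : Mat n) → setCol j (λ r → A r j) A ≐ A
setCol-self j A i c with c ≟ j
... | yes refl = refl
... | no _     = refl

before : ∀ {n} → ℕ → Fin n → Bool
before m c = does (toℕ c ℕ.<? m)

before-self : ∀ {n} {c : Fin n} {m} → toℕ c ≡ m → before m c ≡ false
before-self {c = c} refl = dec-false (toℕ c ℕ.<? toℕ c) (ℕ.<-irrefl refl)

before-suc-self : ∀ {n} {c : Fin n} {m} → toℕ c ≡ m → before (suc m) c ≡ true
before-suc-self {c = c} refl = dec-true (toℕ c ℕ.<? suc (toℕ c)) ℕ.≤-refl

before-suc : ∀ {n} {c c′ : Fin n} {m} → toℕ c ≡ m → c′ ≢ c → before (suc m) c′ ≡ before m c′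
before-suc {c = c} {c′} refl c′≢c with ℕ.<-cmp (toℕ c′) (toℕ c)
... | tri< c′<c _ _ =
  trans (dec-true (toℕ c′ ℕ.<? suc (toℕ c)) (ℕ.m<n⇒m<1+n c′<c)) (sym (dec-true (toℕ c′ ℕ.<? toℕ c) c′<c))
... | tri≈ _ c′≡c _ = ⊥-elim (c′≢c (toℕ-injective c′≡c))
... | tri> _ _ c<c′ = trans (dec-false (toℕ c′ ℕ.<? suc (toℕ c)) (ℕ.<⇒≱ c<c′ ∘ ℕ.≤-pred))
  (sym (dec-false (toℕ c′ ℕ.<? toℕ c) (ℕ.<⇒≱ c<c′ ∘ ℕ.<⇒≤)))

before-all : ∀ {n} (c : Fin n) → before n c ≡ true
before-all c = dec-true (toℕ c ℕ.<? _) (toℕ<n c)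

upTo : ∀ {n} → ℕ → (Fin n → ℚ) → Fin n → ℚ
upTo m f c = if before m c then f c else 0ℚ

sumFin-upTo-suc : ∀ {n} {c : Fin (suc n)} {m} → toℕ c ≡ m → ∀ f → sumFin (upTo (suc m) f) ≡ sumFin (upTo m f) + f c
sumFin-upTo-suc {c = c} {m} tc f = begin
  sumFin (upTo (suc m) f)
    ≡⟨ sumFin-remove c (upTo (suc m) f) ⟩
  upTo (suc m) f c + sumFin (upTo (suc m) f ∘ punchIn c)
    ≡⟨ cong₂ _+_ fc (sumFin-cong others) ⟩
  f c + rest
    ≡⟨ solve 2 (λ x s → x :+ s := (con 0ℚ :+ s) :+ x) refl (f c) rest ⟩
  (0ℚ + rest) + f c
    ≡⟨ cong (λ x → (x + rest) + f c) (sym 0c) ⟩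
  (upTo m f c + sumFin (upTo m f ∘ punchIn c)) + f c
    ≡⟨ cong (_+ f c) (sym (sumFin-remove c (upTo m f))) ⟩
  sumFin (upTo m f) + f c ∎
  where
  rest : ℚ
  rest = sumFin (upTo m f ∘ punchIn c)
  fc : upTo (suc m) f c ≡ f c
  fc rewrite before-suc-self tc = refl
  0c : upTo m f c ≡ 0ℚ
  0c rewrite before-self tc = refl
  others : ∀ j → upTo (suc m) f (punchIn c j) ≡ upTo m f (punchIn c j)
  others j rewrite before-suc tc (punchInᵢ≢i c j) = refl

columnInduction : ∀ {n} (P : ℕ → Set) → P 0 → (∀ m (c : Fin n) → toℕ c ≡ m → P m → P (suc m)) → P n
columnInduction {n} P P₀ step = go n ℕ.≤-refl
  where
  go : ∀ m → m ℕ.≤ n → P m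
  go zero    _   = P₀
  go (suc m) m<n = step m (fromℕ< m<n) (toℕ-fromℕ< m<n) (go m (ℕ.<⇒≤ m<n))

module AltMultilinear {n} {D : Mat n → ℚ} (D-alt : IsAltMultilinear D) where
  open IsAltMultilinear D-alt

  zero-col : ∀ A j → (∀ i → A i j ≡ 0ℚ) → D A ≡ 0ℚ
  zero-col A j Aj≡0 = trans (homogeneous j 0ℚ A A (λ _ _ _ → refl) (λ i → trans (Aj≡0 i) (sym (ℚ.*-zeroˡ (A i j)))))
    (ℚ.*-zeroˡ (D A))

  setCol-* : ∀ j s u A → D (setCol j (λ i → s * u i) A) ≡ s * D (setCol j u A)
  setCol-* j s u A = homogeneous j s (setCol j u A) (setCol j (λ i → s * u i) A) (setCol-agreeOff j u _ A)
    (λ i → trans (setCol-≡ j (λ r → s * u r) A i) (cong (s *_) (sym (setCol-≡ j u A i))))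

  setCol-linear : ∀ j s u v A → D (setCol j (λ i → s * u i + v i) A) ≡ s * D (setCol j u A) + D (setCol j v A)
  setCol-linear j s u v A =
    trans (setCol-+ resp-≐ additive j (λ i → s * u i) v A) (cong (_+ D (setCol j v A)) (setCol-* j s u A))

  setCol-sum : ∀ {m} j (v : Fin m → Fin n → ℚ) A →
    D (setCol j (λ i → sumFin (λ r → v r i)) A) ≡ sumFin (λ r → D (setCol j (v r) A))
  setCol-sum {zero}  j v A = zero-col (setCol j (λ _ → 0ℚ) A) j (setCol-≡ j (λ _ → 0ℚ) A)
  setCol-sum {suc m} j v A = trans (setCol-+ resp-≐ additive j (v zero) (λ i → sumFin (λ r → v (suc r) i)) A)
    (cong (D (setCol j (v zero) A) +_) (setCol-sum j (v ∘ suc) A))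

  setCol-otherCol : ∀ {i j} → i ≢ j → ∀ A → D (setCol j (λ r → A r i) A) ≡ 0ℚ
  setCol-otherCol {i} {j} i≢j A = alternating (setCol j (λ r → A r i) A) i j i≢j
    (λ r → trans (setCol-≢ (λ r → A r i) A r i≢j) (sym (setCol-≡ j (λ r → A r i) A r)))

  addColMultiple : ∀ {i j} → i ≢ j → ∀ s A → D (setCol j (λ r → s * A r i + A r j) A) ≡ D A
  addColMultiple {i} {j} i≢j s A = begin
    D (setCol j (λ r → s * A r i + A r j) A)
      ≡⟨ setCol-linear j s (λ r → A r i) (λ r → A r j) A ⟩
    s * D (setCol j (λ r → A r i) A) + D (setCol j (λ r → A r j) A)
      ≡⟨ cong₂ (λ x y → s * x + y) (setCol-otherCol i≢j A) (resp-≐ (setCol-self j A)) ⟩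
    s * 0ℚ + D A
      ≡⟨ solve 2 (λ s d → s :* con 0ℚ :+ d := d) refl s (D A) ⟩
    D A ∎

  addedUpTo : Fin n → (Fin n → ℚ) → Mat n → ℕ → Mat n
  addedUpTo c s U m i c′ = U i c′ + upTo m s c′ * U i c

  addedUpTo-col : ∀ {c s} → s c ≡ 0ℚ → ∀ U m i → addedUpTo c s U m i c ≡ U i c
  addedUpTo-col {c} {s} sc≡0 U m i with before m c
  ... | true  rewrite sc≡0 = solve 1 (λ u → u :+ con 0ℚ :* u := u) refl (U i c)
  ... | false = solve 1 (λ u → u :+ con 0ℚ :* u := u) refl (U i c)

  addedUpTo-suc : ∀ {c s} → s c ≡ 0ℚ → ∀ U {m cₘ} → toℕ cₘ ≡ m → D (addedUpTo c s U (suc m)) ≡ D (addedUpTo c s U m)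
  addedUpTo-suc {c} {s} sc≡0 U {m} {cₘ} tcₘ with cₘ ≟ c
  ... | yes refl = resp-≐ same
    where
    same : addedUpTo c s U (suc m) ≐ addedUpTo c s U m
    same i c′ with c′ ≟ cₘ
    ... | yes refl = trans (addedUpTo-col {c} {s} sc≡0 U (suc m) i) (sym (addedUpTo-col {c} {s} sc≡0 U m i))
    ... | no c′≢c rewrite before-suc tcₘ c′≢c = refl
  ... | no cₘ≢c = trans (resp-≐ G-step) (addColMultiple (cₘ≢c ∘ sym) (s cₘ) G)
    where
    G = addedUpTo c s U m
    G-step : addedUpTo c s U (suc m) ≐ setCol cₘ (λ r → s cₘ * G r c + G r cₘ) G
    G-step i c′ with c′ ≟ cₘ
    ... | yes refl rewrite before-suc-self tcₘ | before-self tcₘ =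
      trans (solve 3 (λ u s x → u :+ s :* x := s :* x :+ (u :+ con 0ℚ :* x)) refl (U i c′) (s c′) (U i c))
            (cong (λ g → s c′ * g + (U i c′ + 0ℚ * U i c)) (sym (addedUpTo-col {c} {s} sc≡0 U m i)))
    ... | no c′≢cₘ rewrite before-suc tcₘ c′≢cₘ = refl

  addColMultiples : ∀ c (s : Fin n → ℚ) → s c ≡ 0ℚ → ∀ U → D (λ i c′ → U i c′ + s c′ * U i c) ≡ D U
  addColMultiples c s sc≡0 U = begin
    D (λ i c′ → U i c′ + s c′ * U i c)  ≡⟨ resp-≐ final ⟩
    D (addedUpTo c s U n)               ≡⟨ columnInduction (λ m → D (addedUpTo c s U m) ≡ D U) (resp-≐ initial)
                                             (λ m cₘ tcₘ IH → trans (addedUpTo-suc {c} {s} sc≡0 U tcₘ) IH) ⟩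
    D U                                 ∎
    where
    initial : addedUpTo c s U 0 ≐ U
    initial i c′ = solve 2 (λ u x → u :+ con 0ℚ :* x := u) refl (U i c′) (U i c)
    final : (λ i c′ → U i c′ + s c′ * U i c) ≐ addedUpTo c s U n
    final i c′ rewrite before-all c′ = refl

det-zero-col : ∀ {n} (A : Mat n) j → (∀ i → A i j ≡ 0ℚ) → det A ≡ 0ℚ
det-zero-col = AltMultilinear.zero-col det-isAltMultilinear

punchOut-inject₁-suc : ∀ {n} (i : Fin n) (i≢si : inject₁ i ≢ suc i) → punchOut i≢si ≡ i
punchOut-inject₁-suc zero    _    = refl
punchOut-inject₁-suc (suc i) i≢si = cong suc (punchOut-inject₁-suc i (i≢si ∘ cong suc))

punchOut-suc-inject₁ : ∀ {n} (i : Fin n) (si≢i : suc i ≢ inject₁ i) → punchOut si≢i ≡ i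
punchOut-suc-inject₁ zero    _    = refl
punchOut-suc-inject₁ (suc i) si≢i = cong suc (punchOut-suc-inject₁ i (si≢i ∘ cong suc))

punchOut-inject₁≡punchOut-suc : ∀ {n} (i : Fin n) {c} (i≢c : inject₁ i ≢ c) (si≢c : suc i ≢ c) →
  punchOut i≢c ≡ punchOut si≢c
punchOut-inject₁≡punchOut-suc zero    {zero}          i≢c  _    = ⊥-elim (i≢c refl)
punchOut-inject₁≡punchOut-suc zero    {suc zero}      _    si≢c = ⊥-elim (si≢c refl)
punchOut-inject₁≡punchOut-suc zero    {suc (suc c)}   _    _    = refl
punchOut-inject₁≡punchOut-suc (suc i) {zero}          _    _    = refl
punchOut-inject₁≡punchOut-suc (suc i) {suc c}         i≢c  si≢c =
  cong suc (punchOut-inject₁≡punchOut-suc i (i≢c ∘ cong suc) (si≢c ∘ cong suc))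

scalar : ∀ {n} → ℚ → Mat n
scalar t i j = if does (i ≟ j) then t else 0ℚ

I : ∀ {n} → Mat n
I = scalar 1ℚ

e₀ : ∀ {n} → Fin (suc n) → ℚ
e₀ i = I i zero

zeroTop : ∀ {n} → Mat n → Fin (suc n) → Fin n → ℚ
zeroTop C zero    c = 0ℚ
zeroTop C (suc r) c = C r c

insertCol : ∀ {n} → Fin (suc n) → (Fin (suc n) → ℚ) → (Fin (suc n) → Fin n → ℚ) → Mat (suc n)
insertCol k u B i c with c ≟ k
... | yes _   = u i
... | no c≢k  = B i (punchOut (c≢k ∘ sym))

insertCol-≡ : ∀ {n} k u (B : Fin (suc n) → Fin n → ℚ) i → insertCol k u B i k ≡ u i
insertCol-≡ k u B i with k ≟ k
... | yes _   = refl
... | no k≢k  = ⊥-elim (k≢k refl)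

insertCol-≢ : ∀ {n} {k c} u (B : Fin (suc n) → Fin n → ℚ) i (k≢c : k ≢ c) → insertCol k u B i c ≡ B i (punchOut k≢c)
insertCol-≢ {k = k} {c} u B i k≢c with c ≟ k
... | yes c≡k = ⊥-elim (k≢c (sym c≡k))
... | no _    = cong (B i) (punchOut-cong k refl)

insertCol-punchIn : ∀ {n} k u (B : Fin (suc n) → Fin n → ℚ) i c → insertCol k u B i (punchIn k c) ≡ B i c
insertCol-punchIn k u B i c = trans (insertCol-≢ u B i (punchInᵢ≢i k c ∘ sym)) (cong (B i) (punchOut-punchIn k))

insertCol-cong : ∀ {n} k u {B B′ : Fin (suc n) → Fin n → ℚ} → B ≐ B′ → insertCol k u B ≐ insertCol k u B′
insertCol-cong k u B≐B′ i c with c ≟ k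
... | yes _ = refl
... | no _  = B≐B′ i _

insertCol-swap : ∀ {n} (j : Fin n) u (B : Fin (suc n) → Fin n → ℚ) i c →
  insertCol (suc j) u B i c ≡ swapCols (inject₁ j) (suc j) (insertCol (inject₁ j) u B) i c
insertCol-swap j u B i c = cases c (c ≟ inject₁ j) (c ≟ suc j)
  where
  cases : ∀ c → Dec (c ≡ inject₁ j) → Dec (c ≡ suc j) →
    insertCol (suc j) u B i c ≡ swapCols (inject₁ j) (suc j) (insertCol (inject₁ j) u B) i c
  cases _ (yes refl) (yes c≡sj) = ⊥-elim (inject₁≢suc j c≡sj)
  cases _ (yes refl) (no _) = begin
    insertCol (suc j) u B i (inject₁ j)
      ≡⟨ insertCol-≢ u B i (inject₁≢suc j ∘ sym) ⟩
    B i (punchOut (inject₁≢suc j ∘ sym))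
      ≡⟨ cong (B i) (punchOut-suc-inject₁ j _) ⟩
    B i j
      ≡⟨ cong (B i) (sym (punchOut-inject₁-suc j (inject₁≢suc j))) ⟩
    B i (punchOut (inject₁≢suc j))
      ≡⟨ sym (insertCol-≢ u B i (inject₁≢suc j)) ⟩
    insertCol (inject₁ j) u B i (suc j)
      ≡⟨ sym (swapCols-≡ˡ (inject₁ j) (suc j) (insertCol (inject₁ j) u B) i) ⟩
    swapCols (inject₁ j) (suc j) (insertCol (inject₁ j) u B) i (inject₁ j) ∎
  cases _ (no _) (yes refl) = begin
    insertCol (suc j) u B i (suc j)
      ≡⟨ insertCol-≡ (suc j) u B i ⟩
    u i
      ≡⟨ sym (insertCol-≡ (inject₁ j) u B i) ⟩
    insertCol (inject₁ j) u B i (inject₁ j)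
      ≡⟨ sym (swapCols-≡ʳ (insertCol (inject₁ j) u B) i (inject₁≢suc j)) ⟩
    swapCols (inject₁ j) (suc j) (insertCol (inject₁ j) u B) i (suc j) ∎
  cases c (no c≢j) (no c≢sj) = begin
    insertCol (suc j) u B i c
      ≡⟨ insertCol-≢ u B i (c≢sj ∘ sym) ⟩
    B i (punchOut (c≢sj ∘ sym))
      ≡⟨ cong (B i) (sym (punchOut-inject₁≡punchOut-suc j (c≢j ∘ sym) (c≢sj ∘ sym))) ⟩
    B i (punchOut (c≢j ∘ sym))
      ≡⟨ sym (insertCol-≢ u B i (c≢j ∘ sym)) ⟩
    insertCol (inject₁ j) u B i c
      ≡⟨ sym (swapCols-≢ (insertCol (inject₁ j) u B) i c≢j c≢sj) ⟩
    swapCols (inject₁ j) (suc j) (insertCol (inject₁ j) u B) i c ∎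

scalar-≡ : ∀ {n} t (i : Fin n) → scalar t i i ≡ t
scalar-≡ t i rewrite dec-true (i ≟ i) refl = refl

scalar-≢ : ∀ {n} t {i j : Fin n} → i ≢ j → scalar t i j ≡ 0ℚ
scalar-≢ t {i} {j} i≢j rewrite dec-false (i ≟ j) i≢j = refl

sumFin-scalarˡ : ∀ {n} t (f : Fin n → ℚ) i → sumFin (λ l → scalar t i l * f l) ≡ t * f i
sumFin-scalarˡ t f i = trans (sumFin-singleton (λ l → scalar t i l * f l) i vanish) (cong (_* f i) (scalar-≡ t i))
  where
  vanish : ∀ l → l ≢ i → scalar t i l * f l ≡ 0ℚ
  vanish l l≢i = trans (cong (_* f l) (scalar-≢ t (l≢i ∘ sym))) (ℚ.*-zeroˡ (f l))

sumFin-scalarʳ : ∀ {n} t (f : Fin n → ℚ) j → sumFin (λ l → f l * scalar t l j) ≡ f j * t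
sumFin-scalarʳ t f j = trans (sumFin-singleton (λ l → f l * scalar t l j) j vanish) (cong (f j *_) (scalar-≡ t j))
  where
  vanish : ∀ l → l ≢ j → f l * scalar t l j ≡ 0ℚ
  vanish l l≢j = trans (cong (f l *_) (scalar-≢ t l≢j)) (ℚ.*-zeroʳ (f l))

sumFin-scalar-row : ∀ {n} t (i : Fin n) → sumFin (λ j → scalar t i j) ≡ t
sumFin-scalar-row t i = trans (sumFin-singleton (scalar t i) i (λ j j≢i → scalar-≢ t (j≢i ∘ sym))) (scalar-≡ t i)

extend : ∀ {n} → Fin (suc n) → (Fin (suc n) → ℚ) → Mat n → Mat (suc n)
extend k u C = insertCol k u (zeroTop C)

extend-punchIn : ∀ {n} k u (C : Mat n) i c → extend k u C i (punchIn k c) ≡ zeroTop C i c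
extend-punchIn k u C = insertCol-punchIn k u (zeroTop C)

zeroTop-cong : ∀ {n} {A B : Mat n} → A ≐ B → zeroTop A ≐ zeroTop B
zeroTop-cong A≐B zero    c = refl
zeroTop-cong A≐B (suc r) c = A≐B r c

extend-agreeOff : ∀ {n} k u {j} {A C : Mat n} → AgreeOff j A C → AgreeOff (punchIn k j) (extend k u A) (extend k u C)
extend-agreeOff k u {j} {A} {C} A≈C i c c≢kj with c ≟ k
... | yes _   = refl
... | no c≢k  = zeroTop-agree i
  where
  ≢j : punchOut (c≢k ∘ sym) ≢ j
  ≢j e = c≢kj (trans (sym (punchIn-punchOut (c≢k ∘ sym))) (cong (punchIn k) e))
  zeroTop-agree : ∀ i → zeroTop A i (punchOut (c≢k ∘ sym)) ≡ zeroTop C i (punchOut (c≢k ∘ sym))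
  zeroTop-agree zero    = refl
  zeroTop-agree (suc r) = A≈C r _ ≢j

module _ {n} (k : Fin (suc n)) (u : Fin (suc n) → ℚ) where

  extend-col-+ : ∀ {j} {A B C : Mat n} → (∀ i → C i j ≡ A i j + B i j) →
    ∀ i → extend k u C i (punchIn k j) ≡ extend k u A i (punchIn k j) + extend k u B i (punchIn k j)
  extend-col-+ {j} {A} {B} {C} Cj i
    rewrite extend-punchIn k u C i j | extend-punchIn k u A i j | extend-punchIn k u B i j with i
  ... | zero  = sym (ℚ.+-identityʳ 0ℚ)
  ... | suc r = Cj r

  extend-col-* : ∀ {j} s {A C : Mat n} → (∀ i → C i j ≡ s * A i j) →
    ∀ i → extend k u C i (punchIn k j) ≡ s * extend k u A i (punchIn k j)
  extend-col-* {j} s {A} {C} Cj i rewrite extend-punchIn k u C i j | extend-punchIn k u A i j with i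
  ... | zero  = sym (ℚ.*-zeroʳ s)
  ... | suc r = Cj r

  extend-equal-cols : ∀ {p q} {A : Mat n} → (∀ i → A i p ≡ A i q) →
    ∀ i → extend k u A i (punchIn k p) ≡ extend k u A i (punchIn k q)
  extend-equal-cols {p} {q} {A} cols i rewrite extend-punchIn k u A i p | extend-punchIn k u A i q with i
  ... | zero  = refl
  ... | suc r = cols r

extend-isAltMultilinear : ∀ {n} {D : Mat (suc n) → ℚ} → IsAltMultilinear D →
  ∀ k u → IsAltMultilinear (λ C → D (extend k u C))
extend-isAltMultilinear {n} {D} D-alt k u = record
  { resp-≐      = λ A≐B → resp-≐ (insertCol-cong k u (zeroTop-cong A≐B))
  ; additive    = λ j A B C A≈C B≈C Cj → additive (punchIn k j) (extend k u A) (extend k u B) (extend k u C)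
                    (extend-agreeOff k u A≈C) (extend-agreeOff k u B≈C) (extend-col-+ k u Cj)
  ; homogeneous = λ j s A C A≈C Cj → homogeneous (punchIn k j) s (extend k u A) (extend k u C)
                    (extend-agreeOff k u A≈C) (extend-col-* k u s Cj)
  ; alternating = λ A p q p≢q cols → alternating (extend k u A) (punchIn k p) (punchIn k q)
                    (p≢q ∘ punchIn-injective k p q) (extend-equal-cols k u cols)
  }
  where open IsAltMultilinear D-alt

-- Induction step: D expands along the first row like det, D A = Σₖ A₀ₖ D (extend k e₀ (minor A k)),
-- and C ↦ D (extend k e₀ C) is alternating multilinear, so by induction it is det C · D (extend k e₀ I),
-- where D (extend k e₀ I) = (-1)ᵏ D I since extend k e₀ I is I with its first column moved to position k.
module FirstRowExpansion {n} (IH : ∀ {D : Mat n → ℚ} → IsAltMultilinear D → ∀ A → D A ≡ det A * D I)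
                         {D : Mat (suc n) → ℚ} (D-alt : IsAltMultilinear D) where
  open IsAltMultilinear D-alt
  open AltMultilinear D-alt

  extend-IH : ∀ k u C → D (extend k u C) ≡ det C * D (extend k u I)
  extend-IH k u = IH (extend-isAltMultilinear D-alt k u)

  -- The first column u is a combination of the other columns, which are the unit vectors below the top.
  extend-zero-I : ∀ u → u zero ≡ 0ℚ → D (extend zero u I) ≡ 0ℚ
  extend-zero-I u u₀≡0 = begin
    D X                                               ≡⟨ resp-≐ X≐ ⟩
    D (setCol zero (λ i → sumFin (λ r → v r i)) X)    ≡⟨ setCol-sum zero v X ⟩
    sumFin (λ r → D (setCol zero (v r) X))            ≡⟨ sumFin-zero _ each≡0 ⟩
    0ℚ                                                ∎
    where
    X : Mat (suc n)
    X = extend zero u I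
    v : Fin n → Fin (suc n) → ℚ
    v r i = u (suc r) * X i (suc r)
    u≡∑v : ∀ i → u i ≡ sumFin (λ r → v r i)
    u≡∑v zero    = trans u₀≡0 (sym (sumFin-zero (λ r → v r zero) (λ r → ℚ.*-zeroʳ (u (suc r)))))
    u≡∑v (suc i) = sym (begin
      sumFin (λ r → u (suc r) * I i r)  ≡⟨ sumFin-cong (λ r → ℚ.*-comm (u (suc r)) (I i r)) ⟩
      sumFin (λ r → I i r * u (suc r))  ≡⟨ sumFin-scalarˡ 1ℚ (u ∘ suc) i ⟩
      1ℚ * u (suc i)                    ≡⟨ ℚ.*-identityˡ (u (suc i)) ⟩
      u (suc i)                         ∎)
    X≐ : X ≐ setCol zero (λ i → sumFin (λ r → v r i)) X
    X≐ i zero    = u≡∑v i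
    X≐ i (suc c) = refl
    each≡0 : ∀ r → D (setCol zero (v r) X) ≡ 0ℚ
    each≡0 r = begin
      D (setCol zero (v r) X)
        ≡⟨ setCol-* zero (u (suc r)) (λ i → X i (suc r)) X ⟩
      u (suc r) * D (setCol zero (λ i → X i (suc r)) X)
        ≡⟨ cong (u (suc r) *_) (setCol-otherCol {i = suc r} {zero} (λ ()) X) ⟩
      u (suc r) * 0ℚ
        ≡⟨ ℚ.*-zeroʳ (u (suc r)) ⟩
      0ℚ ∎

  zero-topRow : ∀ A → (∀ c → A zero c ≡ 0ℚ) → D A ≡ 0ℚ
  zero-topRow A top≡0 = begin
    D A                          ≡⟨ resp-≐ A≐ ⟩
    D (extend zero u C)          ≡⟨ extend-IH zero u C ⟩
    det C * D (extend zero u I)  ≡⟨ cong (det C *_) (extend-zero-I u (top≡0 zero)) ⟩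
    det C * 0ℚ                   ≡⟨ ℚ.*-zeroʳ (det C) ⟩
    0ℚ                           ∎
    where
    u : Fin (suc n) → ℚ
    u i = A i zero
    C : Mat n
    C r c = A (suc r) (suc c)
    A≐ : A ≐ extend zero u C
    A≐ i       zero    = refl
    A≐ zero    (suc c) = top≡0 (suc c)
    A≐ (suc r) (suc c) = refl

  extend-sign : ∀ k → D (extend k e₀ I) ≡ sign (toℕ k) * D I
  extend-sign = <-weakInduction _ base step
    where
    I≐ : extend zero e₀ I ≐ I
    I≐ i       zero    = refl
    I≐ zero    (suc c) = refl
    I≐ (suc r) (suc c) = refl
    base : D (extend zero e₀ I) ≡ 1ℚ * D I
    base = trans (resp-≐ I≐) (sym (ℚ.*-identityˡ (D I)))
    step : ∀ j → D (extend (inject₁ j) e₀ I) ≡ sign (toℕ (inject₁ j)) * D I →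
      D (extend (suc j) e₀ I) ≡ sign (suc (toℕ j)) * D I
    step j IHⱼ = begin
      D (extend (suc j) e₀ I)
        ≡⟨ resp-≐ (insertCol-swap j e₀ (zeroTop I)) ⟩
      D (swapCols (inject₁ j) (suc j) (extend (inject₁ j) e₀ I))    ≡⟨ swapCols-negates resp-≐ additive (inject₁≢suc j)
                                                                         (λ B → alternating B _ _ (inject₁≢suc j)) _ ⟩
      - D (extend (inject₁ j) e₀ I)
        ≡⟨ cong -_ IHⱼ ⟩
      - (sign (toℕ (inject₁ j)) * D I)
        ≡⟨ solve 2 (λ s d → :- (s :* d) := (:- s) :* d) refl (sign (toℕ (inject₁ j))) (D I) ⟩
      (- sign (toℕ (inject₁ j))) * D I
        ≡⟨ cong (λ m → (- sign m) * D I) (toℕ-inject₁ j) ⟩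
      (- sign (toℕ j)) * D I
        ≡⟨ cong (_* D I) (sym (sign-suc (toℕ j))) ⟩
      sign (suc (toℕ j)) * D I ∎

  module _ (A : Mat (suc n)) where

    expansionTerm : Fin (suc n) → ℚ
    expansionTerm k = A zero k * D (extend k e₀ (minor A k))

    topCleared : ℕ → Mat (suc n)
    topCleared m zero    c = if before m c then 0ℚ else A zero c
    topCleared m (suc r) c = A (suc r) c

    -- Column c of topCleared m is A₀c e₀ plus column c of topCleared (m + 1); in the first summand,
    -- the e₀ column clears the top row of every other column.
    peel : ∀ m c → toℕ c ≡ m → D (topCleared m) ≡ expansionTerm c + D (topCleared (suc m))
    peel m c tc = begin
      D (topCleared m)
        ≡⟨ resp-≐ split ⟩
      D (setCol c (λ i → A zero c * e₀ i + X i c) X)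
        ≡⟨ setCol-linear c (A zero c) e₀ (λ i → X i c) X ⟩
      A zero c * D (setCol c e₀ X) + D (setCol c (λ i → X i c) X)
        ≡⟨ cong₂ (λ x y → A zero c * x + y) (trans (resp-≐ cleared) (addColMultiples c (λ c′ → X zero c′) Xc₀ U))
                                            (resp-≐ (setCol-self c X)) ⟩
      expansionTerm c + D X ∎
      where
      X U : Mat (suc n)
      X = topCleared (suc m)
      U = extend c e₀ (minor A c)
      Xc₀ : X zero c ≡ 0ℚ
      Xc₀ rewrite before-suc-self tc = refl
      split : topCleared m ≐ setCol c (λ i → A zero c * e₀ i + X i c) X
      split i c′ with c′ ≟ c
      split zero    _ | yes refl rewrite before-self tc | before-suc-self tc =
        solve 1 (λ a → a := a :* con 1ℚ :+ con 0ℚ) refl (A zero c)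
      split (suc r) _ | yes refl = solve 2 (λ a b → b := a :* con 0ℚ :+ b) refl (A zero c) (A (suc r) c)
      split zero    c′ | no c′≢c rewrite before-suc tc c′≢c = refl
      split (suc r) _  | no _ = refl
      cleared : setCol c e₀ X ≐ λ i c′ → U i c′ + X zero c′ * U i c
      cleared i c′ rewrite insertCol-≡ c e₀ (zeroTop (minor A c)) i with c′ ≟ c
      cleared i _ | yes refl rewrite Xc₀ = solve 1 (λ e → e := e :+ con 0ℚ :* e) refl (e₀ i)
      cleared zero    c′ | no _ = solve 1 (λ x → x := con 0ℚ :+ x :* con 1ℚ) refl (X zero c′)
      cleared (suc r) c′ | no c′≢c = begin
        A (suc r) c′                                        ≡⟨ cong (A (suc r)) (sym (punchIn-punchOut (c′≢c ∘ sym))) ⟩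
        A (suc r) (punchIn c (punchOut (c′≢c ∘ sym)))       ≡⟨ solve 2 (λ a x → a := a :+ x :* con 0ℚ) refl _ (X zero c′) ⟩
        A (suc r) (punchIn c (punchOut (c′≢c ∘ sym))) + X zero c′ * 0ℚ ∎

    peel-all : D A ≡ sumFin (upTo (suc n) expansionTerm) + D (topCleared (suc n))
    peel-all = columnInduction (λ m → D A ≡ sumFin (upTo m expansionTerm) + D (topCleared m)) initial step
      where
      A≐ : topCleared 0 ≐ A
      A≐ zero    c = refl
      A≐ (suc r) c = refl
      initial : D A ≡ sumFin (upTo 0 expansionTerm) + D (topCleared 0)
      initial = sym (trans (cong₂ _+_ (sumFin-zero (upTo 0 expansionTerm) (λ _ → refl)) (resp-≐ A≐))
                           (ℚ.+-identityˡ (D A)))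
      step : ∀ m c → toℕ c ≡ m → D A ≡ sumFin (upTo m expansionTerm) + D (topCleared m) →
        D A ≡ sumFin (upTo (suc m) expansionTerm) + D (topCleared (suc m))
      step m c tc IHₘ = begin
        D A
          ≡⟨ IHₘ ⟩
        sumFin (upTo m expansionTerm) + D (topCleared m)
          ≡⟨ cong (sumFin (upTo m expansionTerm) +_) (peel m c tc) ⟩
        sumFin (upTo m expansionTerm) + (expansionTerm c + D (topCleared (suc m)))
          ≡⟨ sym (ℚ.+-assoc (sumFin (upTo m expansionTerm)) (expansionTerm c) (D (topCleared (suc m)))) ⟩
        (sumFin (upTo m expansionTerm) + expansionTerm c) + D (topCleared (suc m))
          ≡⟨ cong (_+ D (topCleared (suc m))) (sym (sumFin-upTo-suc tc expansionTerm)) ⟩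
        sumFin (upTo (suc m) expansionTerm) + D (topCleared (suc m)) ∎

    expansion : D A ≡ sumFin expansionTerm
    expansion = trans peel-all (trans (cong₂ _+_ (sumFin-cong all) (zero-topRow (topCleared (suc n)) top≡0))
                                      (ℚ.+-identityʳ _))
      where
      all : ∀ k → upTo (suc n) expansionTerm k ≡ expansionTerm k
      all k rewrite before-all k = refl
      top≡0 : ∀ c → topCleared (suc n) zero c ≡ 0ℚ
      top≡0 c rewrite before-all c = refl

  D≡det* : ∀ A → D A ≡ det A * D I
  D≡det* A = begin
    D A                                        ≡⟨ expansion A ⟩
    sumFin (expansionTerm A)                   ≡⟨ sumFin-cong term≡ ⟩
    sumFin (λ k → laplaceTerm A k * D I)       ≡⟨ sym (*-distribʳ-sumFin (D I) (laplaceTerm A)) ⟩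
    det A * D I                                ∎
    where
    term≡ : ∀ k → expansionTerm A k ≡ laplaceTerm A k * D I
    term≡ k = begin
      A zero k * D (extend k e₀ (minor A k))
        ≡⟨ cong (A zero k *_) (extend-IH k e₀ (minor A k)) ⟩
      A zero k * (det (minor A k) * D (extend k e₀ I))
        ≡⟨ cong (λ x → A zero k * (det (minor A k) * x)) (extend-sign k) ⟩
      A zero k * (det (minor A k) * (sign (toℕ k) * D I))
        ≡⟨ solve 4 (λ a d s x → a :* (d :* (s :* x)) := (s :* (a :* d)) :* x) refl
             (A zero k) (det (minor A k)) (sign (toℕ k)) (D I) ⟩
      laplaceTerm A k * D I ∎

altMultilinear≡det* : ∀ {n} {D : Mat n → ℚ} → IsAltMultilinear D → ∀ A → D A ≡ det A * D I
altMultilinear≡det* {zero}  D-alt A = trans (IsAltMultilinear.resp-≐ D-alt (λ ())) (sym (ℚ.*-identityˡ _))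
altMultilinear≡det* {suc n} D-alt = FirstRowExpansion.D≡det* (altMultilinear≡det* {n}) D-alt

-- Matrix products, the product formula and block matrices

infixl 7 _·_
infixl 6 _+ᴹ_

_·_ : ∀ {a b c} → (Fin a → Fin b → ℚ) → (Fin b → Fin c → ℚ) → Fin a → Fin c → ℚ
(A · B) i j = sumFin (λ l → A i l * B l j)

_+ᴹ_ : ∀ {a b} → (Fin a → Fin b → ℚ) → (Fin a → Fin b → ℚ) → Fin a → Fin b → ℚ
(A +ᴹ B) i j = A i j + B i j

-ᴹ_ : ∀ {a b} → (Fin a → Fin b → ℚ) → Fin a → Fin b → ℚ
(-ᴹ A) i j = - A i j

0ᴹ : ∀ {a b} → Fin a → Fin b → ℚ
0ᴹ _ _ = 0ℚ

charMat : ∀ {n} → ℚ → Mat n → Mat n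
charMat t A i j = scalar t i j - A i j

·-cong : ∀ {a b c} (A : Fin a → Fin b → ℚ) {B B′ : Fin b → Fin c → ℚ} → B ≐ B′ → A · B ≐ A · B′
·-cong A B≐B′ i j = sumFin-cong (λ l → cong (A i l *_) (B≐B′ l j))

scalar-· : ∀ {a b} t (A : Fin a → Fin b → ℚ) → scalar t · A ≐ λ i j → t * A i j
scalar-· t A i j = sumFin-scalarˡ t (λ l → A l j) i

·-scalar : ∀ {a b} t (A : Fin a → Fin b → ℚ) → A · scalar t ≐ λ i j → A i j * t
·-scalar t A i j = sumFin-scalarʳ t (A i) j

·-I : ∀ {a b} (A : Fin a → Fin b → ℚ) → A · I ≐ A
·-I A i j = trans (·-scalar 1ℚ A i j) (ℚ.*-identityʳ (A i j))

I-· : ∀ {a b} (A : Fin a → Fin b → ℚ) → I · A ≐ A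
I-· A i j = trans (scalar-· 1ℚ A i j) (ℚ.*-identityˡ (A i j))

0ᴹ-· : ∀ {a b c} (A : Fin b → Fin c → ℚ) → 0ᴹ {a} · A ≐ 0ᴹ
0ᴹ-· A i j = sumFin-zero (λ l → 0ℚ * A l j) (λ l → ℚ.*-zeroˡ (A l j))

·-0ᴹ : ∀ {a b c} (A : Fin a → Fin b → ℚ) → A · 0ᴹ {b} {c} ≐ 0ᴹ
·-0ᴹ A i j = sumFin-zero (λ l → A i l * 0ℚ) (λ l → ℚ.*-zeroʳ (A i l))

-ᴹ-· : ∀ {a b c} (A : Fin a → Fin b → ℚ) (B : Fin b → Fin c → ℚ) → (-ᴹ A) · B ≐ -ᴹ (A · B)
-ᴹ-· A B i j = begin
  sumFin (λ l → - A i l * B l j)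
    ≡⟨ sumFin-cong (λ l → solve 2 (λ x y → (:- x) :* y := con (- 1ℚ) :* (x :* y)) refl (A i l) (B l j)) ⟩
  sumFin (λ l → - 1ℚ * (A i l * B l j))
    ≡⟨ sym (*-distribˡ-sumFin (- 1ℚ) (λ l → A i l * B l j)) ⟩
  - 1ℚ * (A · B) i j
    ≡⟨ solve 1 (λ s → con (- 1ℚ) :* s := :- s) refl ((A · B) i j) ⟩
  - (A · B) i j ∎

·-ᴹ : ∀ {a b c} (A : Fin a → Fin b → ℚ) (B : Fin b → Fin c → ℚ) → A · (-ᴹ B) ≐ -ᴹ (A · B)
·-ᴹ A B i j = begin
  sumFin (λ l → A i l * - B l j)
    ≡⟨ sumFin-cong (λ l → solve 2 (λ x y → x :* (:- y) := con (- 1ℚ) :* (x :* y)) refl (A i l) (B l j)) ⟩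
  sumFin (λ l → - 1ℚ * (A i l * B l j))
    ≡⟨ sym (*-distribˡ-sumFin (- 1ℚ) (λ l → A i l * B l j)) ⟩
  - 1ℚ * (A · B) i j
    ≡⟨ solve 1 (λ s → con (- 1ℚ) :* s := :- s) refl ((A · B) i j) ⟩
  - (A · B) i j ∎

module _ {a b c : ℕ} (A : Fin a → Fin b → ℚ) where

  ·-agreeOff : ∀ {j} {B B′ : Fin b → Fin c → ℚ} → (∀ l c′ → c′ ≢ j → B l c′ ≡ B′ l c′) →
    ∀ i c′ → c′ ≢ j → (A · B) i c′ ≡ (A · B′) i c′
  ·-agreeOff B≈B′ i c′ c′≢j = sumFin-cong (λ l → cong (A i l *_) (B≈B′ l c′ c′≢j))

  ·-col-+ : ∀ {j} {B₁ B₂ B₃ : Fin b → Fin c → ℚ} → (∀ l → B₃ l j ≡ B₁ l j + B₂ l j) →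
    ∀ i → (A · B₃) i j ≡ (A · B₁) i j + (A · B₂) i j
  ·-col-+ {j} {B₁} {B₂} B₃j i =
    trans (sumFin-cong (λ l → trans (cong (A i l *_) (B₃j l)) (ℚ.*-distribˡ-+ (A i l) (B₁ l j) (B₂ l j))))
    (sumFin-distrib-+ (λ l → A i l * B₁ l j) (λ l → A i l * B₂ l j))

  ·-col-* : ∀ {j} s {B B′ : Fin b → Fin c → ℚ} → (∀ l → B′ l j ≡ s * B l j) → ∀ i → (A · B′) i j ≡ s * (A · B) i j
  ·-col-* {j} s {B} B′j i = trans (sumFin-cong (λ l → trans (cong (A i l *_) (B′j l))
      (solve 3 (λ a s b → a :* (s :* b) := s :* (a :* b)) refl (A i l) s (B l j))))
    (sym (*-distribˡ-sumFin s (λ l → A i l * B l j)))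

  ·-equal-cols : ∀ {p q} {B : Fin b → Fin c → ℚ} → (∀ l → B l p ≡ B l q) → ∀ i → (A · B) i p ≡ (A · B) i q
  ·-equal-cols cols i = sumFin-cong (λ l → cong (A i l *_) (cols l))

det∘A·-isAltMultilinear : ∀ {n} (A : Mat n) → IsAltMultilinear (λ B → det (A · B))
det∘A·-isAltMultilinear A = record
  { resp-≐      = λ B≐B′ → det-cong (·-cong A B≐B′)
  ; additive    = λ j B₁ B₂ B₃ B₁≈B₃ B₂≈B₃ B₃j →
                    det-col-+ j (A · B₁) (A · B₂) (A · B₃) (·-agreeOff A B₁≈B₃) (·-agreeOff A B₂≈B₃)
                      (·-col-+ A {j} {B₁} {B₂} {B₃} B₃j)
  ; homogeneous = λ j s B B′ B≈B′ B′j →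
                    det-col-* j s (A · B) (A · B′) (·-agreeOff A B≈B′) (·-col-* A {j} s {B} {B′} B′j)
  ; alternating = λ B p q p≢q cols → det-equal-cols (A · B) p q p≢q (·-equal-cols A {p} {q} {B} cols)
  }

det-· : ∀ {n} (A B : Mat n) → det (A · B) ≡ det A * det B
det-· A B = begin
  det (A · B)          ≡⟨ altMultilinear≡det* (det∘A·-isAltMultilinear A) B ⟩
  det B * det (A · I)  ≡⟨ cong (det B *_) (det-cong (·-I A)) ⟩
  det B * det A        ≡⟨ ℚ.*-comm (det B) (det A) ⟩
  det A * det B        ∎

block : ∀ {a b} → (Fin a → Fin a → ℚ) → (Fin a → Fin b → ℚ) → (Fin b → Fin a → ℚ) → (Fin b → Fin b → ℚ) → Mat (a ℕ.+ b)
block {a} P Q R S i j =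
  [ (λ i′ → [ P i′ , Q i′ ]′ (splitAt a j)) , (λ i′ → [ R i′ , S i′ ]′ (splitAt a j)) ]′ (splitAt a i)

module _ {a b} (P : Fin a → Fin a → ℚ) (Q : Fin a → Fin b → ℚ) (R : Fin b → Fin a → ℚ) (S : Fin b → Fin b → ℚ) where

  block-↑ˡ-↑ˡ : ∀ i j → block P Q R S (i ↑ˡ b) (j ↑ˡ b) ≡ P i j
  block-↑ˡ-↑ˡ i j rewrite splitAt-↑ˡ a i b | splitAt-↑ˡ a j b = refl

  block-↑ˡ-↑ʳ : ∀ i j → block P Q R S (i ↑ˡ b) (a ↑ʳ j) ≡ Q i j
  block-↑ˡ-↑ʳ i j rewrite splitAt-↑ˡ a i b | splitAt-↑ʳ a b j = refl

  block-↑ʳ-↑ˡ : ∀ i j → block P Q R S (a ↑ʳ i) (j ↑ˡ b) ≡ R i j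
  block-↑ʳ-↑ˡ i j rewrite splitAt-↑ʳ a b i | splitAt-↑ˡ a j b = refl

  block-↑ʳ-↑ʳ : ∀ i j → block P Q R S (a ↑ʳ i) (a ↑ʳ j) ≡ S i j
  block-↑ʳ-↑ʳ i j rewrite splitAt-↑ʳ a b i | splitAt-↑ʳ a b j = refl

↑ˡ⊎↑ʳ : ∀ a b (i : Fin (a ℕ.+ b)) → (Σ (Fin a) λ i′ → i ≡ i′ ↑ˡ b) ⊎ (Σ (Fin b) λ i′ → i ≡ a ↑ʳ i′)
↑ˡ⊎↑ʳ a b i with splitAt a i | join-splitAt a b i
... | inj₁ i′ | i≡ = inj₁ (i′ , sym i≡)
... | inj₂ i′ | i≡ = inj₂ (i′ , sym i≡)

block-cong : ∀ {a b} {P P′ : Fin a → Fin a → ℚ} {Q Q′ : Fin a → Fin b → ℚ}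
               {R R′ : Fin b → Fin a → ℚ} {S S′ : Fin b → Fin b → ℚ} →
  P ≐ P′ → Q ≐ Q′ → R ≐ R′ → S ≐ S′ → block P Q R S ≐ block P′ Q′ R′ S′
block-cong {a} {b} {P} {P′} {Q} {Q′} {R} {R′} {S} {S′} P≐ Q≐ R≐ S≐ i j with ↑ˡ⊎↑ʳ a b i | ↑ˡ⊎↑ʳ a b j
... | inj₁ (i′ , refl) | inj₁ (j′ , refl) =
  trans (block-↑ˡ-↑ˡ P Q R S i′ j′) (trans (P≐ i′ j′) (sym (block-↑ˡ-↑ˡ P′ Q′ R′ S′ i′ j′)))
... | inj₁ (i′ , refl) | inj₂ (j′ , refl) =
  trans (block-↑ˡ-↑ʳ P Q R S i′ j′) (trans (Q≐ i′ j′) (sym (block-↑ˡ-↑ʳ P′ Q′ R′ S′ i′ j′)))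
... | inj₂ (i′ , refl) | inj₁ (j′ , refl) =
  trans (block-↑ʳ-↑ˡ P Q R S i′ j′) (trans (R≐ i′ j′) (sym (block-↑ʳ-↑ˡ P′ Q′ R′ S′ i′ j′)))
... | inj₂ (i′ , refl) | inj₂ (j′ , refl) =
  trans (block-↑ʳ-↑ʳ P Q R S i′ j′) (trans (S≐ i′ j′) (sym (block-↑ʳ-↑ʳ P′ Q′ R′ S′ i′ j′)))

·-splitAt-cong : ∀ {c a b d} (A : Fin c → Fin (a ℕ.+ b) → ℚ) (B : Fin (a ℕ.+ b) → Fin d → ℚ) i j
  {x : Fin a → ℚ} {y : Fin b → ℚ} →
  (∀ l → A i (l ↑ˡ b) * B (l ↑ˡ b) j ≡ x l) → (∀ l → A i (a ↑ʳ l) * B (a ↑ʳ l) j ≡ y l) →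
  (A · B) i j ≡ sumFin x + sumFin y
·-splitAt-cong {a = a} {b} A B i j x≡ y≡ =
  trans (sumFin-splitAt {a} {b} (λ l → A i l * B l j)) (cong₂ _+_ (sumFin-cong x≡) (sumFin-cong y≡))

block-· : ∀ {a b} (P₁ : Fin a → Fin a → ℚ) Q₁ R₁ (S₁ : Fin b → Fin b → ℚ) P₂ Q₂ R₂ S₂ →
  block P₁ Q₁ R₁ S₁ · block P₂ Q₂ R₂ S₂ ≐
  block (P₁ · P₂ +ᴹ Q₁ · R₂) (P₁ · Q₂ +ᴹ Q₁ · S₂) (R₁ · P₂ +ᴹ S₁ · R₂) (R₁ · Q₂ +ᴹ S₁ · S₂)
block-· {a} {b} P₁ Q₁ R₁ S₁ P₂ Q₂ R₂ S₂ i j with ↑ˡ⊎↑ʳ a b i | ↑ˡ⊎↑ʳ a b j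
... | inj₁ (i′ , refl) | inj₁ (j′ , refl) = trans (·-splitAt-cong (block P₁ Q₁ R₁ S₁) (block P₂ Q₂ R₂ S₂) (i′ ↑ˡ b) (j′ ↑ˡ b)
      (λ l → cong₂ _*_ (block-↑ˡ-↑ˡ P₁ Q₁ R₁ S₁ i′ l) (block-↑ˡ-↑ˡ P₂ Q₂ R₂ S₂ l j′))
      (λ l → cong₂ _*_ (block-↑ˡ-↑ʳ P₁ Q₁ R₁ S₁ i′ l) (block-↑ʳ-↑ˡ P₂ Q₂ R₂ S₂ l j′)))
    (sym (block-↑ˡ-↑ˡ _ (P₁ · Q₂ +ᴹ Q₁ · S₂) (R₁ · P₂ +ᴹ S₁ · R₂) (R₁ · Q₂ +ᴹ S₁ · S₂) i′ j′))
... | inj₁ (i′ , refl) | inj₂ (j′ , refl) = trans (·-splitAt-cong (block P₁ Q₁ R₁ S₁) (block P₂ Q₂ R₂ S₂) (i′ ↑ˡ b) (a ↑ʳ j′)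
      (λ l → cong₂ _*_ (block-↑ˡ-↑ˡ P₁ Q₁ R₁ S₁ i′ l) (block-↑ˡ-↑ʳ P₂ Q₂ R₂ S₂ l j′))
      (λ l → cong₂ _*_ (block-↑ˡ-↑ʳ P₁ Q₁ R₁ S₁ i′ l) (block-↑ʳ-↑ʳ P₂ Q₂ R₂ S₂ l j′)))
    (sym (block-↑ˡ-↑ʳ (P₁ · P₂ +ᴹ Q₁ · R₂) _ (R₁ · P₂ +ᴹ S₁ · R₂) (R₁ · Q₂ +ᴹ S₁ · S₂) i′ j′))
... | inj₂ (i′ , refl) | inj₁ (j′ , refl) = trans (·-splitAt-cong (block P₁ Q₁ R₁ S₁) (block P₂ Q₂ R₂ S₂) (a ↑ʳ i′) (j′ ↑ˡ b)
      (λ l → cong₂ _*_ (block-↑ʳ-↑ˡ P₁ Q₁ R₁ S₁ i′ l) (block-↑ˡ-↑ˡ P₂ Q₂ R₂ S₂ l j′))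
      (λ l → cong₂ _*_ (block-↑ʳ-↑ʳ P₁ Q₁ R₁ S₁ i′ l) (block-↑ʳ-↑ˡ P₂ Q₂ R₂ S₂ l j′)))
    (sym (block-↑ʳ-↑ˡ (P₁ · P₂ +ᴹ Q₁ · R₂) (P₁ · Q₂ +ᴹ Q₁ · S₂) _ (R₁ · Q₂ +ᴹ S₁ · S₂) i′ j′))
... | inj₂ (i′ , refl) | inj₂ (j′ , refl) = trans (·-splitAt-cong (block P₁ Q₁ R₁ S₁) (block P₂ Q₂ R₂ S₂) (a ↑ʳ i′) (a ↑ʳ j′)
      (λ l → cong₂ _*_ (block-↑ʳ-↑ˡ P₁ Q₁ R₁ S₁ i′ l) (block-↑ˡ-↑ʳ P₂ Q₂ R₂ S₂ l j′))
      (λ l → cong₂ _*_ (block-↑ʳ-↑ʳ P₁ Q₁ R₁ S₁ i′ l) (block-↑ʳ-↑ʳ P₂ Q₂ R₂ S₂ l j′)))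
    (sym (block-↑ʳ-↑ʳ (P₁ · P₂ +ᴹ Q₁ · R₂) (P₁ · Q₂ +ᴹ Q₁ · S₂) (R₁ · P₂ +ᴹ S₁ · R₂) _ i′ j′))

punchIn-↑ˡ : ∀ {a} b (k : Fin (suc a)) (c : Fin a) → punchIn (k ↑ˡ b) (c ↑ˡ b) ≡ punchIn k c ↑ˡ b
punchIn-↑ˡ b zero    c       = refl
punchIn-↑ˡ b (suc k) zero    = refl
punchIn-↑ˡ b (suc k) (suc c) = cong suc (punchIn-↑ˡ b k c)

punchIn-↑ʳ : ∀ {a} b (k : Fin (suc a)) (c : Fin b) → punchIn (k ↑ˡ b) (a ↑ʳ c) ≡ suc a ↑ʳ c
punchIn-↑ʳ         b zero    c = refl
punchIn-↑ʳ {suc a} b (suc k) c = cong suc (punchIn-↑ʳ b k c)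

minor-block : ∀ {a b} (P : Mat (suc a)) Q R (S : Mat b) k →
  minor (block P Q R S) (k ↑ˡ b) ≐ block (minor P k) (λ r c → Q (suc r) c) (λ r c → R r (punchIn k c)) S
minor-block {a} {b} P Q R S k r c with ↑ˡ⊎↑ʳ a b r | ↑ˡ⊎↑ʳ a b c
... | inj₁ (r′ , refl) | inj₁ (c′ , refl) = trans (cong (block P Q R S (suc r′ ↑ˡ b)) (punchIn-↑ˡ b k c′))
  (trans (block-↑ˡ-↑ˡ P Q R S (suc r′) (punchIn k c′)) (sym (block-↑ˡ-↑ˡ (minor P k) _ _ S r′ c′)))
... | inj₁ (r′ , refl) | inj₂ (c′ , refl) = trans (cong (block P Q R S (suc r′ ↑ˡ b)) (punchIn-↑ʳ b k c′))
  (trans (block-↑ˡ-↑ʳ P Q R S (suc r′) c′) (sym (block-↑ˡ-↑ʳ (minor P k) (λ r c → Q (suc r) c) _ S r′ c′)))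
... | inj₂ (r′ , refl) | inj₁ (c′ , refl) = trans (cong (block P Q R S (suc a ↑ʳ r′)) (punchIn-↑ˡ b k c′))
  (trans (block-↑ʳ-↑ˡ P Q R S r′ (punchIn k c′)) (sym (block-↑ʳ-↑ˡ (minor P k) _ (λ r c → R r (punchIn k c)) S r′ c′)))
... | inj₂ (r′ , refl) | inj₂ (c′ , refl) = trans (cong (block P Q R S (suc a ↑ʳ r′)) (punchIn-↑ʳ b k c′))
  (trans (block-↑ʳ-↑ʳ P Q R S r′ c′) (sym (block-↑ʳ-↑ʳ (minor P k) _ _ S r′ c′)))

det-block-lower : ∀ {a b} (C : Mat a) (Y : Fin b → Fin a → ℚ) (E : Mat b) → det (block C 0ᴹ Y E) ≡ det C * det E
det-block-lower {zero}      C Y E = sym (ℚ.*-identityˡ (det E))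
det-block-lower {suc a} {b} C Y E = begin
  det M
    ≡⟨ sumFin-splitAt {suc a} {b} (laplaceTerm M) ⟩
  sumFin (λ k → laplaceTerm M (k ↑ˡ b)) + sumFin (λ k → laplaceTerm M (suc a ↑ʳ k))
    ≡⟨ cong₂ _+_ (sumFin-cong left) (sumFin-zero _ right) ⟩
  sumFin (λ k → laplaceTerm C k * det E) + 0ℚ
    ≡⟨ ℚ.+-identityʳ _ ⟩
  sumFin (λ k → laplaceTerm C k * det E)
    ≡⟨ sym (*-distribʳ-sumFin (det E) (laplaceTerm C)) ⟩
  det C * det E ∎
  where
  M = block C 0ᴹ Y E
  left : ∀ k → laplaceTerm M (k ↑ˡ b) ≡ laplaceTerm C k * det E
  left k = begin
    sign (toℕ (k ↑ˡ b)) * (M zero (k ↑ˡ b) * det (minor M (k ↑ˡ b)))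
      ≡⟨ cong₂ (λ s x → s * (x * det (minor M (k ↑ˡ b)))) (cong sign (toℕ-↑ˡ k b)) (block-↑ˡ-↑ˡ C 0ᴹ Y E zero k) ⟩
    sign (toℕ k) * (C zero k * det (minor M (k ↑ˡ b)))
      ≡⟨ cong (λ d → sign (toℕ k) * (C zero k * d))
           (trans (det-cong (minor-block C 0ᴹ Y E k)) (det-block-lower (minor C k) _ E)) ⟩
    sign (toℕ k) * (C zero k * (det (minor C k) * det E))
      ≡⟨ solve 4 (λ s x d e → s :* (x :* (d :* e)) := (s :* (x :* d)) :* e) refl
           (sign (toℕ k)) (C zero k) (det (minor C k)) (det E) ⟩
    laplaceTerm C k * det E ∎
  right : ∀ k → laplaceTerm M (suc a ↑ʳ k) ≡ 0ℚ
  right k =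
    trans (cong (λ x → sign (toℕ (suc a ↑ʳ k)) * (x * det (minor M (suc a ↑ʳ k)))) (block-↑ˡ-↑ʳ C 0ᴹ Y E zero k))
    (solve 2 (λ s d → s :* (con 0ℚ :* d) := con 0ℚ) refl (sign (toℕ (suc a ↑ʳ k))) (det (minor M (suc a ↑ʳ k))))

det-block-I : ∀ {a b} (X : Fin a → Fin b → ℚ) (E : Mat b) → det (block I X 0ᴹ E) ≡ det E
det-block-I {zero}      X E = refl
det-block-I {suc a} {b} X E = begin
  det M
    ≡⟨ sumFin-splitAt {suc a} {b} (laplaceTerm M) ⟩
  (laplaceTerm M zero + sumFin (λ k → laplaceTerm M (suc k ↑ˡ b))) + sumFin (λ k → laplaceTerm M (suc a ↑ʳ k))
    ≡⟨ cong₂ _+_ (cong₂ _+_ first (sumFin-zero _ left)) (sumFin-zero _ right) ⟩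
  (det E + 0ℚ) + 0ℚ
    ≡⟨ solve 1 (λ e → (e :+ con 0ℚ) :+ con 0ℚ := e) refl (det E) ⟩
  det E ∎
  where
  M = block I X 0ᴹ E
  first : laplaceTerm M zero ≡ det E
  first =
    trans (cong (λ d → 1ℚ * (1ℚ * d)) (trans (det-cong (minor-block I X 0ᴹ E zero)) (det-block-I (λ r c → X (suc r) c) E)))
    (solve 1 (λ d → con 1ℚ :* (con 1ℚ :* d) := d) refl (det E))
  left : ∀ k → laplaceTerm M (suc k ↑ˡ b) ≡ 0ℚ
  left k =
    trans (cong (λ x → sign (toℕ (suc k ↑ˡ b)) * (x * det (minor M (suc k ↑ˡ b)))) (block-↑ˡ-↑ˡ I X 0ᴹ E zero (suc k)))
    (solve 2 (λ s d → s :* (con 0ℚ :* d) := con 0ℚ) refl (sign (toℕ (suc k ↑ˡ b))) (det (minor M (suc k ↑ˡ b))))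
  right : ∀ k → laplaceTerm M (suc a ↑ʳ k) ≡ 0ℚ
  right k =
    trans (cong (λ d → sign (toℕ (suc a ↑ʳ k)) * (M zero (suc a ↑ʳ k) * d))
                (det-zero-col (minor M (suc a ↑ʳ k)) (punchOut k≢0) firstCol≡0))
    (solve 2 (λ s x → s :* (x :* con 0ℚ) := con 0ℚ) refl (sign (toℕ (suc a ↑ʳ k))) (M zero (suc a ↑ʳ k)))
    where
    k≢0 : suc a ↑ʳ k ≢ zero
    k≢0 ()
    firstCol≡0 : ∀ r → minor M (suc a ↑ʳ k) r (punchOut k≢0) ≡ 0ℚ
    firstCol≡0 r rewrite punchIn-punchOut k≢0 with ↑ˡ⊎↑ʳ a b r
    ... | inj₁ (r′ , refl) = block-↑ˡ-↑ˡ I X 0ᴹ E (suc r′) zero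
    ... | inj₂ (r′ , refl) = block-↑ʳ-↑ˡ I X 0ᴹ E r′ zero

det-scalar : ∀ n t → det (scalar {n} t) ≡ t ^ℚ n
det-scalar zero    t = refl
det-scalar (suc n) t = begin
  1ℚ * (t * det (scalar {n} t)) + sumFin (λ k → laplaceTerm (scalar {suc n} t) (suc k))
    ≡⟨ cong₂ (λ d s → 1ℚ * (t * d) + s) (det-scalar n t)
         (sumFin-zero (λ k → laplaceTerm (scalar {suc n} t) (suc k)) offDiagonal) ⟩
  1ℚ * (t * t ^ℚ n) + 0ℚ
    ≡⟨ solve 2 (λ t p → con 1ℚ :* (t :* p) :+ con 0ℚ := t :* p) refl t (t ^ℚ n) ⟩
  t ^ℚ suc n ∎
  where
  offDiagonal : ∀ k → laplaceTerm (scalar {suc n} t) (suc k) ≡ 0ℚ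
  offDiagonal k =
    solve 2 (λ s d → s :* (con 0ℚ :* d) := con 0ℚ) refl (sign (toℕ (suc k))) (det (minor (scalar {suc n} t) (suc k)))

det-I : ∀ n → det (I {n}) ≡ 1ℚ
det-I n = trans (det-scalar n 1ℚ) (1^ n)
  where
  1^ : ∀ n → 1ℚ ^ℚ n ≡ 1ℚ
  1^ zero    = refl
  1^ (suc n) = trans (cong (1ℚ *_) (1^ n)) (ℚ.*-identityˡ 1ℚ)

-- Sylvester's determinant identity

^ℚ-+ : ∀ t a b → t ^ℚ (a ℕ.+ b) ≡ t ^ℚ a * t ^ℚ b
^ℚ-+ t zero    b = sym (ℚ.*-identityˡ (t ^ℚ b))
^ℚ-+ t (suc a) b = trans (cong (t *_) (^ℚ-+ t a b)) (sym (ℚ.*-assoc t (t ^ℚ a) (t ^ℚ b)))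

*-cancelˡ-≡ : ∀ {t x y} → t ≢ 0ℚ → t * x ≡ t * y → x ≡ y
*-cancelˡ-≡ {t} {x} {y} t≢0 tx≡ty = trans (sym (undo x)) (trans (cong (1/ t *_) tx≡ty) (undo y))
  where
  instance
    t-nonZero : NonZero t
    t-nonZero = ≢-nonZero t≢0
  undo : ∀ z → 1/ t * (t * z) ≡ z
  undo z = trans (sym (ℚ.*-assoc (1/ t) t z)) (trans (cong (_* z) (ℚ.*-inverseˡ t)) (ℚ.*-identityˡ z))

^ℚ-cancelˡ-≡ : ∀ {t x y} k → t ≢ 0ℚ → t ^ℚ k * x ≡ t ^ℚ k * y → x ≡ y
^ℚ-cancelˡ-≡ {t} {x} {y} zero    t≢0 e = trans (sym (ℚ.*-identityˡ x)) (trans e (ℚ.*-identityˡ y))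
^ℚ-cancelˡ-≡ {t} {x} {y} (suc k) t≢0 e = ^ℚ-cancelˡ-≡ k t≢0
  (*-cancelˡ-≡ t≢0 (trans (sym (ℚ.*-assoc t (t ^ℚ k) x)) (trans e (ℚ.*-assoc t (t ^ℚ k) y))))

module _ {n m} (X : Fin n → Fin m → ℚ) (Y : Fin m → Fin n → ℚ) (t : ℚ) where

  sylvesterBlock : Mat (n ℕ.+ m)
  sylvesterBlock = block (scalar t) X Y I

  rowCleared : block I (-ᴹ X) 0ᴹ I · sylvesterBlock ≐ block (charMat t (X · Y)) 0ᴹ Y I
  rowCleared i j = trans (block-· I (-ᴹ X) 0ᴹ I (scalar t) X Y I i j) (block-cong P Q R S i j)
    where
    P : I · scalar t +ᴹ (-ᴹ X) · Y ≐ charMat t (X · Y)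
    P i j = cong₂ _+_ (I-· (scalar t) i j) (-ᴹ-· X Y i j)
    Q : I · X +ᴹ (-ᴹ X) · I ≐ 0ᴹ
    Q i j = trans (cong₂ _+_ (I-· X i j) (·-I (-ᴹ X) i j)) (ℚ.+-inverseʳ (X i j))
    R : 0ᴹ · scalar t +ᴹ I · Y ≐ Y
    R i j = trans (cong₂ _+_ (0ᴹ-· (scalar t) i j) (I-· Y i j)) (ℚ.+-identityˡ (Y i j))
    S : 0ᴹ · X +ᴹ I · I ≐ I
    S i j = trans (cong₂ _+_ (0ᴹ-· X i j) (I-· I i j)) (ℚ.+-identityˡ (I i j))

  colCleared : sylvesterBlock · block I (-ᴹ X) 0ᴹ (scalar t) ≐ block (scalar t) 0ᴹ Y (charMat t (Y · X))
  colCleared i j = trans (block-· (scalar t) X Y I I (-ᴹ X) 0ᴹ (scalar t) i j) (block-cong P Q R S i j)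
    where
    P : scalar t · I +ᴹ X · 0ᴹ ≐ scalar t
    P i j = trans (cong₂ _+_ (·-I (scalar t) i j) (·-0ᴹ X i j)) (ℚ.+-identityʳ (scalar t i j))
    Q : scalar t · (-ᴹ X) +ᴹ X · scalar t ≐ 0ᴹ
    Q i j = trans (cong₂ _+_ (scalar-· t (-ᴹ X) i j) (·-scalar t X i j))
      (solve 2 (λ t x → t :* (:- x) :+ x :* t := con 0ℚ) refl t (X i j))
    R : Y · I +ᴹ I · 0ᴹ ≐ Y
    R i j = trans (cong₂ _+_ (·-I Y i j) (·-0ᴹ I i j)) (ℚ.+-identityʳ (Y i j))
    S : Y · (-ᴹ X) +ᴹ I · scalar t ≐ charMat t (Y · X)
    S i j = trans (cong₂ _+_ (·-ᴹ Y X i j) (I-· (scalar t) i j)) (ℚ.+-comm _ (scalar t i j))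

  det-sylvesterBlock : det sylvesterBlock ≡ det (charMat t (X · Y))
  det-sylvesterBlock = begin
    det sylvesterBlock                                    ≡⟨ sym (ℚ.*-identityˡ (det sylvesterBlock)) ⟩
    1ℚ * det sylvesterBlock                               ≡⟨ cong (_* det sylvesterBlock) (sym det-L) ⟩
    det (block I (-ᴹ X) 0ᴹ I) * det sylvesterBlock        ≡⟨ sym (det-· (block I (-ᴹ X) 0ᴹ I) sylvesterBlock) ⟩
    det (block I (-ᴹ X) 0ᴹ I · sylvesterBlock)            ≡⟨ det-cong rowCleared ⟩
    det (block (charMat t (X · Y)) 0ᴹ Y I)                ≡⟨ det-block-lower (charMat t (X · Y)) Y I ⟩
    det (charMat t (X · Y)) * det (I {m})                 ≡⟨ cong (det (charMat t (X · Y)) *_) (det-I m) ⟩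
    det (charMat t (X · Y)) * 1ℚ                          ≡⟨ ℚ.*-identityʳ _ ⟩
    det (charMat t (X · Y))                               ∎
    where
    det-L : det (block I (-ᴹ X) 0ᴹ I) ≡ 1ℚ
    det-L = trans (det-block-I (-ᴹ X) I) (det-I m)

sylvester : ∀ {n m} (X : Fin n → Fin m → ℚ) (Y : Fin m → Fin n → ℚ) t →
  det (charMat t (X · Y)) * t ^ℚ m ≡ t ^ℚ n * det (charMat t (Y · X))
sylvester {n} {m} X Y t = begin
  det (charMat t (X · Y)) * t ^ℚ m                       ≡⟨ cong₂ _*_ (sym (det-sylvesterBlock X Y t)) (sym det-R) ⟩
  det (sylvesterBlock X Y t) * det R                     ≡⟨ sym (det-· (sylvesterBlock X Y t) R) ⟩
  det (sylvesterBlock X Y t · R)                         ≡⟨ det-cong (colCleared X Y t) ⟩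
  det (block (scalar t) 0ᴹ Y (charMat t (Y · X)))        ≡⟨ det-block-lower (scalar t) Y (charMat t (Y · X)) ⟩
  det (scalar {n} t) * det (charMat t (Y · X))           ≡⟨ cong (_* det (charMat t (Y · X))) (det-scalar n t) ⟩
  t ^ℚ n * det (charMat t (Y · X))                       ∎
  where
  R : Mat (n ℕ.+ m)
  R = block I (-ᴹ X) 0ᴹ (scalar t)
  det-R : det R ≡ t ^ℚ m
  det-R = trans (det-block-I (-ᴹ X) (scalar t)) (det-scalar m t)

charMat-0 : ∀ {n} (A : Mat n) → charMat 0ℚ A ≐ -ᴹ A
charMat-0 A i j with does (i ≟ j)
... | true  = ℚ.+-identityˡ (- A i j)
... | false = ℚ.+-identityˡ (- A i j)

charMat-0-· : ∀ {n m} (A : Fin n → Fin m → ℚ) (B : Fin m → Fin n → ℚ) → charMat 0ℚ (A · B) ≐ (-ᴹ A) · B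
charMat-0-· A B i j = trans (charMat-0 (A · B) i j) (sym (-ᴹ-· A B i j))

charMat-shift : ∀ {n} x s (A B : Mat n) → B ≐ A +ᴹ scalar s → det (charMat x A) ≡ det (charMat (x + s) B)
charMat-shift x s A B B≐ = det-cong shifted
  where
  shifted : ∀ i j → scalar x i j - A i j ≡ scalar (x + s) i j - B i j
  shifted i j rewrite B≐ i j with does (i ≟ j)
  ... | true  = solve 3 (λ x s a → x :- a := (x :+ s) :- (a :+ s)) refl x s (A i j)
  ... | false = solve 1 (λ a → con 0ℚ :- a := con 0ℚ :- (a :+ con 0ℚ)) refl (A i j)

-- Padding Y with zero columns and X with zero rows does not change Y · X, and the padded Y has a zero column.
det-·-thin : ∀ {n m} → n ℕ.< m → (Y : Fin m → Fin n → ℚ) (X : Fin n → Fin m → ℚ) → det (Y · X) ≡ 0ℚ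
det-·-thin {n} n<m with ℕ.m≤n⇒∃[o]m+o≡n n<m
... | d , 1+n+d≡m = padded (trans (ℕ.+-suc n d) 1+n+d≡m)
  where
  padded : ∀ {m} → n ℕ.+ suc d ≡ m → (Y : Fin m → Fin n → ℚ) (X : Fin n → Fin m → ℚ) → det (Y · X) ≡ 0ℚ
  padded refl Y X = begin
    det (Y · X)     ≡⟨ det-cong Y·X≐ ⟩
    det (Y′ · X′)   ≡⟨ det-· Y′ X′ ⟩
    det Y′ * det X′ ≡⟨ cong (_* det X′) (det-zero-col Y′ (n ↑ʳ zero) (λ i → Y′-pad i zero)) ⟩
    0ℚ * det X′     ≡⟨ ℚ.*-zeroˡ (det X′) ⟩
    0ℚ              ∎
    where
    Y′ X′ : Mat (n ℕ.+ suc d)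
    Y′ i l = [ Y i , (λ _ → 0ℚ) ]′ (splitAt n l)
    X′ l j = [ (λ l′ → X l′ j) , (λ _ → 0ℚ) ]′ (splitAt n l)
    Y′-pad : ∀ i l → Y′ i (n ↑ʳ l) ≡ 0ℚ
    Y′-pad i l rewrite splitAt-↑ʳ n (suc d) l = refl
    Y·X≐ : Y · X ≐ Y′ · X′
    Y·X≐ i j = sym (begin
      (Y′ · X′) i j                        ≡⟨ ·-splitAt-cong Y′ X′ i j main pad ⟩
      (Y · X) i j + sumFin {suc d} (λ _ → 0ℚ) ≡⟨ cong ((Y · X) i j +_) (sumFin-zero {suc d} (λ _ → 0ℚ) (λ _ → refl)) ⟩
      (Y · X) i j + 0ℚ                     ≡⟨ ℚ.+-identityʳ ((Y · X) i j) ⟩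
      (Y · X) i j                          ∎)
      where
      main : ∀ l → Y′ i (l ↑ˡ suc d) * X′ (l ↑ˡ suc d) j ≡ Y i l * X l j
      main l rewrite splitAt-↑ˡ n l (suc d) = refl
      pad : ∀ l → Y′ i (n ↑ʳ l) * X′ (n ↑ʳ l) j ≡ 0ℚ
      pad l rewrite splitAt-↑ʳ n (suc d) l = ℚ.*-zeroˡ 0ℚ

sylvester-≤ : ∀ {n m} (X : Fin n → Fin m → ℚ) (Y : Fin m → Fin n → ℚ) t → n ℕ.≤ m →
  det (charMat t (Y · X)) ≡ t ^ℚ (m ∸ n) * det (charMat t (X · Y))
sylvester-≤ {n} {m} X Y t n≤m with t ℚ.≟ 0ℚ
... | no t≢0 = ^ℚ-cancelˡ-≡ n t≢0 (begin
  t ^ℚ n * det (charMat t (Y · X))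
    ≡⟨ sym (sylvester X Y t) ⟩
  det (charMat t (X · Y)) * t ^ℚ m
    ≡⟨ cong (λ k → det (charMat t (X · Y)) * t ^ℚ k) (sym (ℕ.m+[n∸m]≡n n≤m)) ⟩
  det (charMat t (X · Y)) * t ^ℚ (n ℕ.+ (m ∸ n))
    ≡⟨ cong (det (charMat t (X · Y)) *_) (^ℚ-+ t n (m ∸ n)) ⟩
  det (charMat t (X · Y)) * (t ^ℚ n * t ^ℚ (m ∸ n))
    ≡⟨ solve 3 (λ d a b → d :* (a :* b) := a :* (b :* d)) refl (det (charMat t (X · Y))) (t ^ℚ n) (t ^ℚ (m ∸ n)) ⟩
  t ^ℚ n * (t ^ℚ (m ∸ n) * det (charMat t (X · Y))) ∎)
... | yes refl with ℕ.m≤n⇒m<n∨m≡n n≤m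
...   | inj₁ n<m = begin
  det (charMat 0ℚ (Y · X))                          ≡⟨ det-cong (charMat-0-· Y X) ⟩
  det ((-ᴹ Y) · X)                                  ≡⟨ det-·-thin n<m (-ᴹ Y) X ⟩
  0ℚ                                                ≡⟨ sym (ℚ.*-zeroˡ (det (charMat 0ℚ (X · Y)))) ⟩
  0ℚ * det (charMat 0ℚ (X · Y))                     ≡⟨ cong (_* det (charMat 0ℚ (X · Y))) (sym (0^-pos (ℕ.m<n⇒0<n∸m n<m))) ⟩
  0ℚ ^ℚ (m ∸ n) * det (charMat 0ℚ (X · Y))          ∎
  where
  0^-pos : ∀ {k} → 0 ℕ.< k → 0ℚ ^ℚ k ≡ 0ℚ
  0^-pos {suc k} _ = ℚ.*-zeroˡ (0ℚ ^ℚ k)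
...   | inj₂ refl rewrite ℕ.n∸n≡0 n = begin
  det (charMat 0ℚ (Y · X))                          ≡⟨ det-cong (charMat-0-· Y X) ⟩
  det ((-ᴹ Y) · X)                                  ≡⟨ det-· (-ᴹ Y) X ⟩
  det (-ᴹ Y) * det X                                ≡⟨ ℚ.*-comm (det (-ᴹ Y)) (det X) ⟩
  det X * det (-ᴹ Y)                                ≡⟨ sym (det-· X (-ᴹ Y)) ⟩
  det (X · (-ᴹ Y))                                  ≡⟨ det-cong (λ i j → trans (·-ᴹ X Y i j) (sym (charMat-0 (X · Y) i j))) ⟩
  det (charMat 0ℚ (X · Y))                          ≡⟨ sym (ℚ.*-identityˡ _) ⟩
  1ℚ * det (charMat 0ℚ (X · Y))                     ∎

sylvester-≥ : ∀ {n m} (X : Fin n → Fin m → ℚ) (Y : Fin m → Fin n → ℚ) t → m ℕ.≤ n →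
  det (charMat t (Y · X)) * t ^ℚ (n ∸ m) ≡ det (charMat t (X · Y))
sylvester-≥ {n} {m} X Y t m≤n = trans (ℚ.*-comm (det (charMat t (Y · X))) (t ^ℚ (n ∸ m))) (sym (sylvester-≤ Y X t m≤n))

ℕ→ℚ≡mkℚ : ∀ a → ℕ→ℚ a ≡ mkℚ (ℤ.+ a) 0 (Coprime.sym (Coprime.1-coprimeTo a))
ℕ→ℚ≡mkℚ a = ℚ.normalize-coprime (Coprime.sym (Coprime.1-coprimeTo a))

ℕ→ℚ-injective : ∀ {a b} → ℕ→ℚ a ≡ ℕ→ℚ b → a ≡ b
ℕ→ℚ-injective {a} {b} e = ℤ.+-injective (cong ↥_ (trans (sym (ℕ→ℚ≡mkℚ a)) (trans e (ℕ→ℚ≡mkℚ b))))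

ℕ→ℚ-suc : ∀ a → ℕ→ℚ (suc a) ≡ 1ℚ + ℕ→ℚ a
ℕ→ℚ-suc a = trans (ℚ./-cong {ℤ.+ suc a} {1} (cong (ℤ._+_ (ℤ.+ 1)) (sym (ℤ.*-identityʳ (ℤ.+ a)))) refl)
                  (cong (1ℚ +_) (sym (ℕ→ℚ≡mkℚ a)))

ℕ→ℚ-+ : ∀ a b → ℕ→ℚ (a ℕ.+ b) ≡ ℕ→ℚ a + ℕ→ℚ b
ℕ→ℚ-+ zero    b = sym (ℚ.+-identityˡ (ℕ→ℚ b))
ℕ→ℚ-+ (suc a) b = begin
  ℕ→ℚ (suc a ℕ.+ b)           ≡⟨ ℕ→ℚ-suc (a ℕ.+ b) ⟩
  1ℚ + ℕ→ℚ (a ℕ.+ b)          ≡⟨ cong (1ℚ +_) (ℕ→ℚ-+ a b) ⟩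
  1ℚ + (ℕ→ℚ a + ℕ→ℚ b)        ≡⟨ sym (ℚ.+-assoc 1ℚ (ℕ→ℚ a) (ℕ→ℚ b)) ⟩
  (1ℚ + ℕ→ℚ a) + ℕ→ℚ b        ≡⟨ cong (_+ ℕ→ℚ b) (sym (ℕ→ℚ-suc a)) ⟩
  ℕ→ℚ (suc a) + ℕ→ℚ b         ∎

ℕ→ℚ-* : ∀ a b → ℕ→ℚ (a ℕ.* b) ≡ ℕ→ℚ a * ℕ→ℚ b
ℕ→ℚ-* zero    b = sym (ℚ.*-zeroˡ (ℕ→ℚ b))
ℕ→ℚ-* (suc a) b = begin
  ℕ→ℚ (b ℕ.+ a ℕ.* b)         ≡⟨ trans (ℕ→ℚ-+ b (a ℕ.* b)) (cong (ℕ→ℚ b +_) (ℕ→ℚ-* a b)) ⟩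
  ℕ→ℚ b + ℕ→ℚ a * ℕ→ℚ b       ≡⟨ solve 2 (λ x y → y :+ x :* y := (con 1ℚ :+ x) :* y) refl (ℕ→ℚ a) (ℕ→ℚ b) ⟩
  (1ℚ + ℕ→ℚ a) * ℕ→ℚ b        ≡⟨ cong (_* ℕ→ℚ b) (sym (ℕ→ℚ-suc a)) ⟩
  ℕ→ℚ (suc a) * ℕ→ℚ b         ∎

+[m*n]/n≡m : ∀ m d → (ℤ.+ (m ℕ.* suc d)) /ℚ suc d ≡ ℕ→ℚ m
+[m*n]/n≡m m d = ℚ.fromℚᵘ-cong {mkℚᵘ (ℤ.+ (m ℕ.* suc d)) d} {mkℚᵘ (ℤ.+ m) 0}
  (*≡* (trans (ℤ.*-identityʳ _) (ℤ.pos-* m (suc d))))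

sumFin-const : ∀ m c → sumFin {m} (λ _ → c) ≡ ℕ→ℚ m * c
sumFin-const zero    c = sym (ℚ.*-zeroˡ c)
sumFin-const (suc m) c = begin
  c + sumFin {m} (λ _ → c)    ≡⟨ cong (c +_) (sumFin-const m c) ⟩
  c + ℕ→ℚ m * c               ≡⟨ solve 2 (λ x c → c :+ x :* c := (con 1ℚ :+ x) :* c) refl (ℕ→ℚ m) c ⟩
  (1ℚ + ℕ→ℚ m) * c            ≡⟨ cong (_* c) (sym (ℕ→ℚ-suc m)) ⟩
  ℕ→ℚ (suc m) * c             ∎

𝟙 : Bool → ℚ
𝟙 b = if b then 1ℚ else 0ℚ

𝟙-∧ : ∀ x y → 𝟙 x * 𝟙 y ≡ 𝟙 (x ∧ y)
𝟙-∧ true  y = ℚ.*-identityˡ (𝟙 y)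
𝟙-∧ false y = ℚ.*-zeroˡ (𝟙 y)

sumFin-𝟙-lookup : ∀ {n} (S : Subset n) → sumFin (λ v → 𝟙 (lookup S v)) ≡ ℕ→ℚ ∣ S ∣
sumFin-𝟙-lookup []          = refl
sumFin-𝟙-lookup (true ∷ S)  = trans (cong (1ℚ +_) (sumFin-𝟙-lookup S)) (sym (ℕ→ℚ-suc ∣ S ∣))
sumFin-𝟙-lookup (false ∷ S) = trans (ℚ.+-identityˡ _) (sumFin-𝟙-lookup S)

sumFin-𝟙 : ∀ {n} (f : Fin n → Bool) → sumFin (λ v → 𝟙 (f v)) ≡ ℕ→ℚ ∣ tabulate f ∣
sumFin-𝟙 f = trans (sumFin-cong (λ v → cong 𝟙 (sym (lookup∘tabulate f v)))) (sumFin-𝟙-lookup (tabulate f))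

sumFin-𝟙-unique : ∀ {n} (f : Fin n → Bool) {a₀} → f a₀ ≡ true → (∀ a → f a ≡ true → a ≡ a₀) →
  sumFin (λ a → 𝟙 (f a)) ≡ 1ℚ
sumFin-𝟙-unique f {a₀} fa₀ unique = trans (sumFin-singleton (λ a → 𝟙 (f a)) a₀ vanish) (cong 𝟙 fa₀)
  where
  vanish : ∀ a → a ≢ a₀ → 𝟙 (f a) ≡ 0ℚ
  vanish a a≢a₀ with f a in fa
  ... | true  = ⊥-elim (a≢a₀ (unique a fa))
  ... | false = refl

-- The row of vertex 0 in a star graph is an arbitrary Boolean vector, which exposes the counting
-- function local to the definition of degree.
star : ∀ {m} → (Fin m → Bool) → Graph (suc m)
star {m} f = record { adj = star-adj ; sym = star-sym ; irrefl = star-irrefl }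
  where
  star-adj : Fin (suc m) → Fin (suc m) → Bool
  star-adj zero    zero    = false
  star-adj zero    (suc j) = f j
  star-adj (suc j) zero    = f j
  star-adj (suc _) (suc _) = false
  star-sym : ∀ i j → star-adj i j ≡ star-adj j i
  star-sym zero    zero    = refl
  star-sym zero    (suc j) = refl
  star-sym (suc i) zero    = refl
  star-sym (suc i) (suc j) = refl
  star-irrefl : ∀ i → star-adj i i ≡ false
  star-irrefl zero    = refl
  star-irrefl (suc i) = refl

degree-star : ∀ {m} (f : Fin m → Bool) → degree (star f) zero ≡ ∣ tabulate f ∣
degree-star {zero}  f = refl
degree-star {suc m} f with f zero
... | true  = cong suc (degree-star (f ∘ suc))
... | false = degree-star (f ∘ suc)

degree≡∣neighbours∣ : ∀ {n} (G : Graph n) u → degree G u ≡ ∣ tabulate (adj G u) ∣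
degree≡∣neighbours∣ {suc n} G u with adj G u zero
... | true  = cong suc (degree-star (λ j → adj G u (suc j)))
... | false = degree-star (λ j → adj G u (suc j))

∧≡true : ∀ {x y} → (x ∧ y) ≡ true → x ≡ true × y ≡ true
∧≡true {true} {true} _ = refl , refl

-- Vertex-clique incidence

module CliqueIncidence {n ω′ M k} (G : Graph n) (regular : IsRegular G k) (cliqueRegular : IsCliqueRegular G (suc ω′))
                       (E : CliqueEnum G (suc ω′) M) where

  ω : ℕ
  ω = suc ω′

  _∈ᶜ_ : Fin n → Fin M → Bool
  v ∈ᶜ a = lookup (cl E a) v

  N : Fin n → Fin M → ℚ
  N v a = 𝟙 (v ∈ᶜ a)

  Nᵀ : Fin M → Fin n → ℚ
  Nᵀ a v = N v a

  cliquesAt : Fin n → ℕ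
  cliquesAt v = ∣ tabulate (v ∈ᶜ_) ∣

  ∈ᶜ⇒∈ : ∀ {v a} → v ∈ᶜ a ≡ true → v ∈ cl E a
  ∈ᶜ⇒∈ {v} {a} = lookup⇒[]= v (cl E a)

  ∈⇒∈ᶜ : ∀ {v a} → v ∈ cl E a → v ∈ᶜ a ≡ true
  ∈⇒∈ᶜ = []=⇒lookup

  clique-size : ∀ a → sumFin (λ v → N v a) ≡ ℕ→ℚ ω
  clique-size a = trans (sumFin-𝟙-lookup (cl E a)) (cong ℕ→ℚ (proj₁ (isClique E a)))

  adjacent-in-clique : ∀ {u v a} → u ≢ v → u ∈ᶜ a ≡ true → v ∈ᶜ a ≡ true → adj G u v ≡ true
  adjacent-in-clique {a = a} u≢v ua va = proj₂ (isClique E a) _ _ (∈ᶜ⇒∈ ua) (∈ᶜ⇒∈ va) u≢v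

  same-clique : ∀ {u v a b} → u ≢ v → u ∈ᶜ a ≡ true → v ∈ᶜ a ≡ true → u ∈ᶜ b ≡ true → v ∈ᶜ b ≡ true → a ≡ b
  same-clique {u} {v} {a} {b} u≢v ua va ub vb = inj E a b
    (proj₂ (proj₂ cliqueRegular u v (adjacent-in-clique u≢v ua va))
      (cl E a) (cl E b) (isClique E a) (∈ᶜ⇒∈ ua) (∈ᶜ⇒∈ va) (isClique E b) (∈ᶜ⇒∈ ub) (∈ᶜ⇒∈ vb))

  Nᵀ·N≐ : Nᵀ · N ≐ adjMat (cliqueAdj E) +ᴹ scalar (ℕ→ℚ ω)
  Nᵀ·N≐ a b = trans (sumFin-cong (λ v → 𝟙-∧ (v ∈ᶜ a) (v ∈ᶜ b))) common
    where
    common : sumFin (λ v → 𝟙 (v ∈ᶜ a ∧ v ∈ᶜ b)) ≡ adjMat (cliqueAdj E) a b + scalar (ℕ→ℚ ω) a b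
    common with a ≟ b
    ... | yes refl = begin
      sumFin (λ v → 𝟙 (v ∈ᶜ a ∧ v ∈ᶜ a))   ≡⟨ sumFin-cong (λ v → cong 𝟙 (∧-idem (v ∈ᶜ a))) ⟩
      sumFin (λ v → N v a)                  ≡⟨ clique-size a ⟩
      ℕ→ℚ ω                                 ≡⟨ sym (ℚ.+-identityˡ (ℕ→ℚ ω)) ⟩
      0ℚ + ℕ→ℚ ω                            ∎
    ... | no a≢b with nonempty? (cl E a ∩ cl E b)
    ...   | yes (v , v∈a∩b) = sumFin-𝟙-unique (λ u → u ∈ᶜ a ∧ u ∈ᶜ b) v∈both unique
      where
      va : v ∈ᶜ a ≡ true
      va = ∈⇒∈ᶜ (proj₁ (x∈p∩q⁻ (cl E a) (cl E b) v∈a∩b))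
      vb : v ∈ᶜ b ≡ true
      vb = ∈⇒∈ᶜ (proj₂ (x∈p∩q⁻ (cl E a) (cl E b) v∈a∩b))
      v∈both : (v ∈ᶜ a ∧ v ∈ᶜ b) ≡ true
      v∈both rewrite va | vb = refl
      unique : ∀ u → (u ∈ᶜ a ∧ u ∈ᶜ b) ≡ true → u ≡ v
      unique u u∈both with u ≟ v | ∧≡true u∈both
      ... | yes u≡v | _         = u≡v
      ... | no u≢v  | ua , ub   = ⊥-elim (a≢b (same-clique u≢v ua va ub vb))
    ...   | no a∩b≡∅ = sumFin-zero _ disjoint
      where
      disjoint : ∀ u → 𝟙 (u ∈ᶜ a ∧ u ∈ᶜ b) ≡ 0ℚ
      disjoint u with u ∈ᶜ a ∧ u ∈ᶜ b in u∈both
      ... | true  = ⊥-elim (a∩b≡∅ (u , x∈p∩q⁺ (∈ᶜ⇒∈ (proj₁ (∧≡true u∈both)) , ∈ᶜ⇒∈ (proj₂ (∧≡true u∈both)))))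
      ... | false = refl

  N·Nᵀ-offDiagonal : ∀ {u v} → u ≢ v → (N · Nᵀ) u v ≡ adjMat (adj G) u v
  N·Nᵀ-offDiagonal {u} {v} u≢v = trans (sumFin-cong (λ a → 𝟙-∧ (u ∈ᶜ a) (v ∈ᶜ a))) common
    where
    common : sumFin (λ a → 𝟙 (u ∈ᶜ a ∧ v ∈ᶜ a)) ≡ adjMat (adj G) u v
    common with adj G u v in uv
    ... | true = through (proj₁ (proj₂ cliqueRegular u v uv))
      where
      through : (∃ λ S → IsClique G ω S × u ∈ S × v ∈ S) → sumFin (λ a → 𝟙 (u ∈ᶜ a ∧ v ∈ᶜ a)) ≡ 1ℚ
      through (S , S-clique , u∈S , v∈S) = sumFin-𝟙-unique (λ a → u ∈ᶜ a ∧ v ∈ᶜ a) both unique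
        where
        a₀ = proj₁ (surj E S S-clique)
        ua₀ : u ∈ᶜ a₀ ≡ true
        ua₀ = ∈⇒∈ᶜ (subst (u ∈_) (sym (proj₂ (surj E S S-clique))) u∈S)
        va₀ : v ∈ᶜ a₀ ≡ true
        va₀ = ∈⇒∈ᶜ (subst (v ∈_) (sym (proj₂ (surj E S S-clique))) v∈S)
        both : (u ∈ᶜ a₀ ∧ v ∈ᶜ a₀) ≡ true
        both rewrite ua₀ | va₀ = refl
        unique : ∀ a → (u ∈ᶜ a ∧ v ∈ᶜ a) ≡ true → a ≡ a₀
        unique a uv∈a = same-clique u≢v (proj₁ (∧≡true uv∈a)) (proj₂ (∧≡true uv∈a)) ua₀ va₀
    ... | false = sumFin-zero _ none
      where
      none : ∀ a → 𝟙 (u ∈ᶜ a ∧ v ∈ᶜ a) ≡ 0ℚ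
      none a with u ∈ᶜ a ∧ v ∈ᶜ a in uv∈a
      ... | true  = case-absurd (trans (sym (adjacent-in-clique u≢v (proj₁ (∧≡true uv∈a)) (proj₂ (∧≡true uv∈a)))) uv)
        where
        case-absurd : true ≡ false → 𝟙 true ≡ 0ℚ
        case-absurd ()
      ... | false = refl

  N·Nᵀ-diagonal : ∀ u → (N · Nᵀ) u u ≡ ℕ→ℚ (cliquesAt u)
  N·Nᵀ-diagonal u =
    trans (sumFin-cong (λ a → trans (𝟙-∧ (u ∈ᶜ a) (u ∈ᶜ a)) (cong 𝟙 (∧-idem (u ∈ᶜ a))))) (sumFin-𝟙 (u ∈ᶜ_))

  N·Nᵀ-entry : ∀ u v → (N · Nᵀ) u v ≡ adjMat (adj G) u v + scalar (ℕ→ℚ (cliquesAt u)) u v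
  N·Nᵀ-entry u v with u ≟ v
  ... | yes refl rewrite irrefl G u = trans (N·Nᵀ-diagonal u) (sym (ℚ.+-identityˡ _))
  ... | no u≢v = trans (N·Nᵀ-offDiagonal u≢v) (sym (ℚ.+-identityʳ _))

  -- Count the pairs (v, clique through u and v) by v and by clique.
  cliquesAt-regular : ∀ u → cliquesAt u ℕ.* ω′ ≡ k
  cliquesAt-regular u = ℕ→ℚ-injective (begin
    ℕ→ℚ (c ℕ.* ω′)                          ≡⟨ ℕ→ℚ-* c ω′ ⟩
    ℕ→ℚ c * ℕ→ℚ ω′                          ≡⟨ solve 2 (λ c w → c :* w := c :* (con 1ℚ :+ w) :- c) refl (ℕ→ℚ c) (ℕ→ℚ ω′) ⟩
    ℕ→ℚ c * (1ℚ + ℕ→ℚ ω′) - ℕ→ℚ c           ≡⟨ cong (λ w → ℕ→ℚ c * w - ℕ→ℚ c) (sym (ℕ→ℚ-suc ω′)) ⟩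
    ℕ→ℚ c * ℕ→ℚ ω - ℕ→ℚ c                   ≡⟨ cong (_- ℕ→ℚ c) (trans (sym by-cliques) by-vertices) ⟩
    (ℕ→ℚ k + ℕ→ℚ c) - ℕ→ℚ c                 ≡⟨ solve 2 (λ k c → (k :+ c) :- c := k) refl (ℕ→ℚ k) (ℕ→ℚ c) ⟩
    ℕ→ℚ k                                   ∎)
    where
    c = cliquesAt u
    by-cliques : sumFin (λ v → (N · Nᵀ) u v) ≡ ℕ→ℚ c * ℕ→ℚ ω
    by-cliques = begin
      sumFin (λ v → sumFin (λ a → N u a * N v a))   ≡⟨ sumFin-comm (λ v a → N u a * N v a) ⟩
      sumFin (λ a → sumFin (λ v → N u a * N v a))   ≡⟨ sumFin-cong (λ a → sym (*-distribˡ-sumFin (N u a) (λ v → N v a))) ⟩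
      sumFin (λ a → N u a * sumFin (λ v → N v a))   ≡⟨ sumFin-cong (λ a → cong (N u a *_) (clique-size a)) ⟩
      sumFin (λ a → N u a * ℕ→ℚ ω)                  ≡⟨ sym (*-distribʳ-sumFin (ℕ→ℚ ω) (N u)) ⟩
      sumFin (N u) * ℕ→ℚ ω                          ≡⟨ cong (_* ℕ→ℚ ω) (sumFin-𝟙 (u ∈ᶜ_)) ⟩
      ℕ→ℚ c * ℕ→ℚ ω                                 ∎
    by-vertices : sumFin (λ v → (N · Nᵀ) u v) ≡ ℕ→ℚ k + ℕ→ℚ c
    by-vertices = begin
      sumFin (λ v → (N · Nᵀ) u v)
        ≡⟨ sumFin-cong (N·Nᵀ-entry u) ⟩
      sumFin (λ v → adjMat (adj G) u v + scalar (ℕ→ℚ c) u v)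
        ≡⟨ sumFin-distrib-+ (adjMat (adj G) u) (scalar (ℕ→ℚ c) u) ⟩
      sumFin (adjMat (adj G) u) + sumFin (scalar (ℕ→ℚ c) u)
        ≡⟨ cong₂ _+_ degree-sum (sumFin-scalar-row (ℕ→ℚ c) u) ⟩
      ℕ→ℚ k + ℕ→ℚ c ∎
      where
      degree-sum : sumFin (adjMat (adj G) u) ≡ ℕ→ℚ k
      degree-sum = trans (sumFin-𝟙 (adj G u)) (cong ℕ→ℚ (trans (sym (degree≡∣neighbours∣ G u)) (regular u)))

  clique-count : M ℕ.* (ω ℕ.* ω′) ≡ n ℕ.* k
  clique-count = ℕ→ℚ-injective (begin
    ℕ→ℚ (M ℕ.* (ω ℕ.* ω′))
      ≡⟨ trans (ℕ→ℚ-* M (ω ℕ.* ω′)) (cong (ℕ→ℚ M *_) (ℕ→ℚ-* ω ω′)) ⟩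
    ℕ→ℚ M * (ℕ→ℚ ω * ℕ→ℚ ω′)
      ≡⟨ sym (ℚ.*-assoc (ℕ→ℚ M) (ℕ→ℚ ω) (ℕ→ℚ ω′)) ⟩
    (ℕ→ℚ M * ℕ→ℚ ω) * ℕ→ℚ ω′
      ≡⟨ cong (_* ℕ→ℚ ω′) incidences ⟩
    sumFin (λ v → ℕ→ℚ (cliquesAt v)) * ℕ→ℚ ω′
      ≡⟨ *-distribʳ-sumFin (ℕ→ℚ ω′) (λ v → ℕ→ℚ (cliquesAt v)) ⟩
    sumFin (λ v → ℕ→ℚ (cliquesAt v) * ℕ→ℚ ω′)
      ≡⟨ sumFin-cong (λ v → trans (sym (ℕ→ℚ-* (cliquesAt v) ω′)) (cong ℕ→ℚ (cliquesAt-regular v))) ⟩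
    sumFin {n} (λ _ → ℕ→ℚ k)
      ≡⟨ sumFin-const n (ℕ→ℚ k) ⟩
    ℕ→ℚ n * ℕ→ℚ k
      ≡⟨ sym (ℕ→ℚ-* n k) ⟩
    ℕ→ℚ (n ℕ.* k) ∎)
    where
    incidences : ℕ→ℚ M * ℕ→ℚ ω ≡ sumFin (λ v → ℕ→ℚ (cliquesAt v))
    incidences = begin
      ℕ→ℚ M * ℕ→ℚ ω                             ≡⟨ sym (sumFin-const M (ℕ→ℚ ω)) ⟩
      sumFin {M} (λ _ → ℕ→ℚ ω)                  ≡⟨ sym (sumFin-cong clique-size) ⟩
      sumFin (λ a → sumFin (λ v → N v a))       ≡⟨ sym (sumFin-comm N) ⟩
      sumFin (λ v → sumFin (N v))               ≡⟨ sumFin-cong (λ v → sumFin-𝟙 (v ∈ᶜ_)) ⟩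
      sumFin (λ v → ℕ→ℚ (cliquesAt v))          ∎

  charPoly-cliqueGraph : ∀ x → charPoly (cliqueAdj E) x ≡ det (charMat (x + ℕ→ℚ ω) (Nᵀ · N))
  charPoly-cliqueGraph x = charMat-shift x (ℕ→ℚ ω) (adjMat (cliqueAdj E)) (Nᵀ · N) Nᵀ·N≐

  charPoly-graph : ∀ {r} → (∀ u → ℕ→ℚ (cliquesAt u) ≡ r) → ∀ t → charPoly (adj G) (t - r) ≡ det (charMat t (N · Nᵀ))
  charPoly-graph {r} cliquesAt≡r t = begin
    charPoly (adj G) (t - r)            ≡⟨ charMat-shift (t - r) r (adjMat (adj G)) (N · Nᵀ) N·Nᵀ≐ ⟩
    det (charMat (t - r + r) (N · Nᵀ))  ≡⟨ cong (λ z → det (charMat z (N · Nᵀ))) (solve 2 (λ t r → (t :- r) :+ r := t) refl t r) ⟩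
    det (charMat t (N · Nᵀ))            ∎
    where
    N·Nᵀ≐ : N · Nᵀ ≐ adjMat (adj G) +ᴹ scalar r
    N·Nᵀ≐ u v = trans (N·Nᵀ-entry u v) (cong (λ c → adjMat (adj G) u v + scalar c u v) (cliquesAt≡r u))

-- `+_` would make every section `(x +_)` above ambiguous, so it is brought into scope only here.
open import Data.Integer.Base using (+_)

theorem8 : (w n k M : ℕ) (G : Graph n) → IsRegular G k → IsCliqueRegular G (2 ℕ.+ w)
    → (E : CliqueEnum G (2 ℕ.+ w) M) → (x : ℚ)
    → let ω = 2 ℕ.+ w
          m = (n ℕ.* k) / (ω ℕ.* (ω ∸ 1))
          y = x + ℕ→ℚ ω - (+ k) /ℚ (ω ∸ 1)
      in (n ≤ m → charPoly (cliqueAdj E) x ≡ ((x + ℕ→ℚ ω) ^ℚ (m ∸ n)) * charPoly (adj G) y)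
       × (m ≤ n → charPoly (cliqueAdj E) x * ((x + ℕ→ℚ ω) ^ℚ (n ∸ m)) ≡ charPoly (adj G) y)
theorem8 w n k M G regular cliqueRegular E x = ≤-case , ≥-case
  where
  open CliqueIncidence G regular cliqueRegular E
  t r : ℚ
  t = x + ℕ→ℚ ω
  r = (+ k) /ℚ (ω ∸ 1)
  m≡M : (n ℕ.* k) / (ω ℕ.* (ω ∸ 1)) ≡ M
  m≡M = trans (cong (_/ (ω ℕ.* (ω ∸ 1))) (sym clique-count)) (m*n/n≡m M (ω ℕ.* (ω ∸ 1)))
  graph-side : charPoly (adj G) (t - r) ≡ det (charMat t (N · Nᵀ))
  graph-side = charPoly-graph (λ u → subst (λ k′ → ℕ→ℚ (cliquesAt u) ≡ (+ k′) /ℚ suc w) (cliquesAt-regular u)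
                                       (sym (+[m*n]/n≡m (cliquesAt u) w))) t
  ≤-case : n ≤ (n ℕ.* k) / (ω ℕ.* (ω ∸ 1)) →
    charPoly (cliqueAdj E) x ≡ t ^ℚ ((n ℕ.* k) / (ω ℕ.* (ω ∸ 1)) ∸ n) * charPoly (adj G) (t - r)
  ≤-case n≤m = trans (charPoly-cliqueGraph x) (trans (sylvester-≤ N Nᵀ t (subst (n ≤_) m≡M n≤m))
    (cong₂ (λ e d → t ^ℚ (e ∸ n) * d) (sym m≡M) (sym graph-side)))
  ≥-case : (n ℕ.* k) / (ω ℕ.* (ω ∸ 1)) ≤ n →
    charPoly (cliqueAdj E) x * t ^ℚ (n ∸ (n ℕ.* k) / (ω ℕ.* (ω ∸ 1))) ≡ charPoly (adj G) (t - r)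
  ≥-case m≤n = trans (cong₂ (λ d e → d * t ^ℚ (n ∸ e)) (charPoly-cliqueGraph x) m≡M)
    (trans (sylvester-≥ N Nᵀ t (subst (_≤ n) m≡M m≤n)) (sym graph-side))
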